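{- Let $\mathbb{F}$ be a field and let $f,g$ be noncommutative p-families with $f\leq_{abp} g$. If $g$ has polynomial-size noncommutative algebraic branching programs (respectively, polynomial-size noncommutative arithmetic circuits, polynomial-size noncommutative skew circuits), then so does $f$.
   Context: A p-family is a sequence $f=(f_n)$ of noncommutative polynomials $f_n\in\mathbb{F}\langle X_n\rangle$ whose number of variables and degree are bounded by $n^c$. A noncommutative arithmetic circuit is a DAG with inputs labelled by variables or field elements and fan-in-2 $+$/$\times$ gates, $\times$ gates having ordered children; a skew circuit is one where each $\times$ gate has an input (variable or constant) as a child. A noncommutative algebraic branching program (ABP) is a layered DAG with a source $s$ (layer 0) and sink $t$ (last layer), edges going between consecutive layers and labelled by linear forms; it computes the sum over $s$-$t$ paths of the ordered product of edge labels; size is the number of vertices. For $f_n\in\mathbb{F}\langle X_n\rangle$, $g_n\in\mathbb{F}\langle Y_n\rangle$: $f\leq_{abp} g$ if there are polynomials $p(n),q(n)$ and maps $\phi$ sending each variable of $Y_{p(n)}$ to a $q(n)\times q(n)$ matrix with entries field elements or variables of $X_n$ (the paper also allows constant-degree monomials over $X_n$), such that $f_n$ is the $(1,q(n))$ entry of $g_{p(n)}(\phi(Y_{p(n)}))$. Polynomial size means size bounded by a polynomial in $n$. -}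

module Defs where

open import Level using (Level; _⊔_)
open import Data.Nat using (ℕ; zero; suc; _^_; _≤_; _<_) renaming (_+_ to _+ℕ_; _*_ to _*ℕ_)
open import Data.Fin using (Fin; zero; suc; fromℕ)
open import Data.Fin.Properties using () renaming (_≟_ to _≟ᶠ_)
open import Data.List using (List; []; _∷_; length; map; concat; concatMap; foldr)
open import Data.List using () renaming (allFin to allFinL; upTo to upToL)
open import Data.Vec using (Vec; []; _∷ʳ_; lookup; last)
open import Data.Bool using (Bool; true; false; T)
open import Data.Product using (Σ; ∃; _×_; _,_)
open import Data.Sum using (_⊎_)
open import Data.Unit.Polymorphic using (⊤)
open import Relation.Nullary using (¬_; yes; no)
open import Algebra.Bundles using (CommutativeRing)

record Field (c ℓ : Level) : Set (Level.suc (c ⊔ ℓ)) where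
  field
    commutativeRing : CommutativeRing c ℓ
  open CommutativeRing commutativeRing public
  field
    0≉1     : ¬ (0# ≈ 1#)
    inverse : ∀ x → ¬ (x ≈ 0#) → Σ Carrier λ y → x * y ≈ 1#

-- Polynomially bounded functions ℕ → ℕ.
-- Every polynomial bound p(n) is dominated by c·n^c + c for some c.

polyBound : ℕ → ℕ → ℕ
polyBound c n = c *ℕ n ^ c +ℕ c

PolyBounded : (ℕ → ℕ) → Set
PolyBounded s = ∃ λ c → ∀ n → s n ≤ polyBound c n

-- Words (noncommutative monomials) over variables x₀ … x_{n-1}

Word : ℕ → Set
Word n = List (Fin n)

wordsOf : (m k : ℕ) → List (Word m)
wordsOf m zero    = [] ∷ []
wordsOf m (suc k) = concatMap (λ i → map (i ∷_) (wordsOf m k)) (allFinL m)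

wordsUpTo : (m D : ℕ) → List (Word m)
wordsUpTo m D = concatMap (wordsOf m) (upToL (suc D))

splits : ∀ {a} {A : Set a} → List A → List (List A × List A)
splits []       = ([] , []) ∷ []
splits (x ∷ xs) = ([] , x ∷ xs) ∷ map (λ { (u , v) → (x ∷ u , v) }) (splits xs)

module NC {c ℓ} (F : Field c ℓ) where
  open Field F using (Carrier; _≈_; _+_; _*_; 0#; 1#)

  sumL : List Carrier → Carrier
  sumL = foldr _+_ 0#

  sumFin : (k : ℕ) → (Fin k → Carrier) → Carrier
  sumFin zero    h = 0#
  sumFin (suc k) h = h zero + sumFin k (λ i → h (suc i))

  Series : ℕ → Set c
  Series n = Word n → Carrier

  _≈ₛ_ : ∀ {n} → Series n → Series n → Set ℓ
  a ≈ₛ b = ∀ w → a w ≈ b w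

  0ₛ : ∀ {n} → Series n
  0ₛ w = 0#

  constₛ : ∀ {n} → Carrier → Series n
  constₛ a []      = a
  constₛ a (_ ∷ _) = 0#

  1ₛ : ∀ {n} → Series n
  1ₛ = constₛ 1#

  varₛ : ∀ {n} → Fin n → Series n
  varₛ i (j ∷ []) with i ≟ᶠ j
  ... | yes _ = 1#
  ... | no  _ = 0#
  varₛ i _ = 0#

  _+ₛ_ : ∀ {n} → Series n → Series n → Series n
  (a +ₛ b) w = a w + b w

  _•ₛ_ : ∀ {n} → Carrier → Series n → Series n
  (x •ₛ a) w = x * a w

  _*ₛ_ : ∀ {n} → Series n → Series n → Series n
  (a *ₛ b) w = sumL (map (λ { (u , v) → a u * b v }) (splits w))

  sumFinₛ : ∀ {n} (k : ℕ) → (Fin k → Series n) → Series n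
  sumFinₛ k h w = sumFin k (λ i → h i w)

  record NCPoly (n : ℕ) : Set (c ⊔ ℓ) where
    field
      coeff  : Series n
      bound  : ℕ
      vanish : ∀ w → bound < length w → coeff w ≈ 0#
  open NCPoly public

  DegLE : ∀ {n} → NCPoly n → ℕ → Set ℓ
  DegLE p d = ∀ w → d < length w → coeff p w ≈ 0#

  Computes : ∀ {n} → Series n → NCPoly n → Set ℓ
  Computes s p = s ≈ₛ coeff p

  record PFamily : Set (c ⊔ ℓ) where
    field
      nv        : ℕ → ℕ
      poly      : (n : ℕ) → NCPoly (nv n)
      nvPoly    : PolyBounded nv
      degPoly   : ∃ λ d → ∀ n → DegLE (poly n) (polyBound d n)
  open PFamily public

  Mat : ℕ → ℕ → Set c
  Mat n q = Fin q → Fin q → Series n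

  idM : ∀ {n q} → Mat n q
  idM {q = q} i j with i ≟ᶠ j
  ... | yes _ = 1ₛ
  ... | no  _ = 0ₛ

  _*M_ : ∀ {n q} → Mat n q → Mat n q → Mat n q
  _*M_ {q = q} A B i j = sumFinₛ q (λ k → A i k *ₛ B k j)

  _+M_ : ∀ {n q} → Mat n q → Mat n q → Mat n q
  (A +M B) i j = A i j +ₛ B i j

  0M : ∀ {n q} → Mat n q
  0M i j = 0ₛ

  _•M_ : ∀ {n q} → Carrier → Mat n q → Mat n q
  (x •M A) i j = x •ₛ A i j

  prodM : ∀ {n q m} → (Fin m → Mat n q) → Word m → Mat n q
  prodM M []      = idM
  prodM M (i ∷ w) = M i *M prodM M w

  substM : ∀ {n q m} → NCPoly m → (Fin m → Mat n q) → Mat n q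
  substM g M =
    foldr (λ w acc → (coeff g w •M prodM M w) +M acc) 0M
          (wordsUpTo _ (bound g))

  data Entry (n : ℕ) : Set c where
    cst : Carrier → Entry n
    var : Fin n → Entry n

  entryₛ : ∀ {n} → Entry n → Series n
  entryₛ (cst a) = constₛ a
  entryₛ (var i) = varₛ i

  -- f ≤abp g  (matrices of dimension suc (q n); entry (1,q) is
  -- (zero , fromℕ (q n)) in 0-based indexing)
  record _≤abp_ (f g : PFamily) : Set (c ⊔ ℓ) where
    field
      p      : ℕ → ℕ
      q      : ℕ → ℕ
      pPoly  : PolyBounded p
      qPoly  : PolyBounded q
      φ      : (n : ℕ) → Fin (nv g (p n)) →
               Fin (suc (q n)) → Fin (suc (q n)) → Entry (nv f n)
      correct : ∀ n →
        Computes (substM (poly g (p n)) (λ y i j → entryₛ (φ n y i j))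
                   zero (fromℕ (q n)))
                 (poly f n)

  -- Noncommutative arithmetic circuits (straight-line programs).
  -- A circuit with k gates lists them in topological order; each gate
  -- refers only to earlier gates.  The output is the last gate.

  data Gate (n k : ℕ) : Set c where
    inVar   : Fin n → Gate n k
    inConst : Carrier → Gate n k
    add     : Fin k → Fin k → Gate n k
    mul     : Fin k → Fin k → Gate n k   -- ordered: left child · right child

  data Circuit (n : ℕ) : ℕ → Set c where
    []  : Circuit n 0
    _▷_ : ∀ {k} → Circuit n k → Gate n k → Circuit n (suc k)

  evalGate : ∀ {n k} → Vec (Series n) k → Gate n k → Series n
  evalGate vs (inVar i)   = varₛ i
  evalGate vs (inConst a) = constₛ a
  evalGate vs (add i j)   = lookup vs i +ₛ lookup vs j
  evalGate vs (mul i j)   = lookup vs i *ₛ lookup vs j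

  evalC : ∀ {n k} → Circuit n k → Vec (Series n) k
  evalC []      = []
  evalC (C ▷ g) = evalC C ∷ʳ evalGate (evalC C) g

  isInput : ∀ {n k} → Gate n k → Bool
  isInput (inVar _)   = true
  isInput (inConst _) = true
  isInput (add _ _)   = false
  isInput (mul _ _)   = false

  inputFlags : ∀ {n k} → Circuit n k → Vec Bool k
  inputFlags []      = []
  inputFlags (C ▷ g) = inputFlags C ∷ʳ isInput g

  SkewGate : ∀ {n k} → Vec Bool k → Gate n k → Set
  SkewGate fl (mul i j) = T (lookup fl i) ⊎ T (lookup fl j)
  SkewGate fl _         = ⊤

  Skew : ∀ {n k} → Circuit n k → Set
  Skew []      = ⊤
  Skew (C ▷ g) = Skew C × SkewGate (inputFlags C) g

  outC : ∀ {n k} → Circuit n (suc k) → Series n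
  outC C = last (evalC C)

  -- Built layer by layer: layer 0 is {s}; each new layer of width w'
  -- is attached to the previous one (width w) by a w × w' matrix of
  -- (affine) linear forms; a missing edge is the zero form.  The ABP is
  -- complete when the last layer has the single vertex t.

  LinForm : ℕ → Set c
  LinForm n = Carrier × (Fin n → Carrier)

  linₛ : ∀ {n} → LinForm n → Series n
  linₛ {n} (a₀ , a) = constₛ a₀ +ₛ sumFinₛ n (λ i → a i •ₛ varₛ i)

  data ABP (n : ℕ) : ℕ → Set c where
    source : ABP n 1
    layer  : ∀ {w w'} → ABP n w → (Fin w → Fin w' → LinForm n) → ABP n w'

  sizeA : ∀ {n w} → ABP n w → ℕ
  sizeA source                = 1
  sizeA (layer {w' = w'} A E) = sizeA A +ℕ w'

  -- value at vertex v of the last layer: sum over s–v paths of the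
  -- ordered product of the edge labels
  evalA : ∀ {n w} → ABP n w → Fin w → Series n
  evalA source      v  = 1ₛ
  evalA (layer {w = w} A E) v' = sumFinₛ w (λ v → evalA A v *ₛ linₛ (E v v'))

  HasPolyABP : PFamily → Set (c ⊔ ℓ)
  HasPolyABP f = ∃ λ e → ∀ n →
    Σ (ABP (nv f n) 1) λ A →
      sizeA A ≤ polyBound e n × Computes (evalA A zero) (poly f n)

  HasPolyCircuit : PFamily → Set (c ⊔ ℓ)
  HasPolyCircuit f = ∃ λ e → ∀ n → Σ ℕ λ k →
    Σ (Circuit (nv f n) (suc k)) λ C →
      suc k ≤ polyBound e n × Computes (outC C) (poly f n)

  HasPolySkewCircuit : PFamily → Set (c ⊔ ℓ)
  HasPolySkewCircuit f = ∃ λ e → ∀ n → Σ ℕ λ k →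
    Σ (Circuit (nv f n) (suc k)) λ C →
      Skew C × suc k ≤ polyBound e n × Computes (outC C) (poly f n)

module Submission where

-- Let φ send each variable y of g_{p(n)} to a (q+1)×(q+1) matrix M_y of constants and
-- variables, so that f_n is the (0, q) entry of g_{p(n)}(M).  Any model of g is turned into
-- one for f by computing matrices instead of scalars.  In an ABP, vertex v becomes q+1
-- vertices (v, k) computing entry (0, k) of the value at v, and an edge label ℓ becomes
-- the matrix ℓ(M), whose entries are again affine linear forms.  In a circuit every gate
-- becomes a table of (q+1)² gates: sums entrywise, products as inner products of length
-- q+1.  If one factor of a product is an input, its table consists of input gates, so
-- skew circuits stay skew.  Sizes grow by a factor O(q³), hence stay polynomial.
-- Values are compared as series; substitution into a series is truncated at a degree
-- bound, which is harmless because every model computes something of bounded degree.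

open import Defs
open import Level using (Level)
open import Data.Product using (_×_; _,_)

module PolyBounds where

  open import Data.Nat
  open import Data.Nat.Properties
  open import Data.Product using (∃; _,_)
  open import Relation.Binary.PropositionalEquality
  open import Data.Nat.Tactic.RingSolver

  -- Bounds of the shape a·(n+1)^k are closed under the arithmetic operations
  -- without extra additive terms, unlike polyBound.
  scaledPow : ℕ → ℕ → ℕ → ℕ
  scaledPow a k n = a * suc n ^ k

  *-≤scaledPow : ∀ {x y} a b k l n → x ≤ scaledPow a k n → y ≤ scaledPow b l n →
                 x * y ≤ scaledPow (a * b) (k + l) n
  *-≤scaledPow a b k l n x≤ y≤ = ≤-trans (*-mono-≤ x≤ y≤) (≤-reflexive regroup)
    where
    regroup : a * suc n ^ k * (b * suc n ^ l) ≡ a * b * suc n ^ (k + l)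
    regroup rewrite ^-distribˡ-+-* (suc n) k l = interchange a b (suc n ^ k) (suc n ^ l)
      where
      interchange : ∀ a b x y → a * x * (b * y) ≡ a * b * (x * y)
      interchange = solve-∀

  +-≤scaledPow : ∀ {x y} a b k n → x ≤ scaledPow a k n → y ≤ scaledPow b k n →
                 x + y ≤ scaledPow (a + b) k n
  +-≤scaledPow a b k n x≤ y≤ =
    ≤-trans (+-mono-≤ x≤ y≤) (≤-reflexive (sym (*-distribʳ-+ (suc n ^ k) a b)))

  ^-≤scaledPow : ∀ {x} a k n e → x ≤ scaledPow a k n → x ^ e ≤ scaledPow (a ^ e) (k * e) n
  ^-≤scaledPow a k n zero    x≤ rewrite *-zeroʳ k = ≤-refl
  ^-≤scaledPow a k n (suc e) x≤ rewrite *-suc k e =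
    *-≤scaledPow a (a ^ e) k (k * e) n x≤ (^-≤scaledPow a k n e x≤)

  suc-≤scaledPow : ∀ {x} a k n → x ≤ scaledPow a k n → suc x ≤ scaledPow (suc a) k n
  suc-≤scaledPow a k n x≤ = +-mono-≤ (m^n>0 (suc n) k) x≤

  ≤scaledPow : ∀ a k n → a ≤ scaledPow a k n
  ≤scaledPow a k n = ≤-trans (≤-reflexive (sym (*-identityʳ a))) (*-monoʳ-≤ a (m^n>0 (suc n) k))

  ^-distribʳ-* : ∀ x y k → (x * y) ^ k ≡ x ^ k * y ^ k
  ^-distribʳ-* x y zero    = refl
  ^-distribʳ-* x y (suc k) rewrite ^-distribʳ-* x y k = regroup x y (x ^ k) (y ^ k)
    where
    regroup : ∀ x y a b → x * y * (a * b) ≡ x * a * (y * b)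
    regroup = solve-∀

  polyBound≤scaledPow : ∀ c n → polyBound c n ≤ scaledPow (c + c) c n
  polyBound≤scaledPow c n =
    ≤-trans (+-mono-≤ (*-monoʳ-≤ c (^-monoˡ-≤ c (n≤1+n n))) (≤scaledPow c c n))
            (≤-reflexive (sym (*-distribʳ-+ (suc n ^ c) c c)))

  scaledPow≤polyBound : ∀ a k n → scaledPow a k n ≤ polyBound (a * 2 ^ k + k) n
  scaledPow≤polyBound a k zero = begin
    a * 1 ^ k  ≡⟨ cong (a *_) (^-zeroˡ k) ⟩
    a * 1      ≡⟨ *-identityʳ a ⟩
    a          ≤⟨ m≤m*n a (2 ^ k) {{m^n≢0 2 k}} ⟩
    a * 2 ^ k  ≤⟨ m≤m+n (a * 2 ^ k) k ⟩
    c          ≤⟨ m≤n+m c (c * 0 ^ c) ⟩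
    polyBound c 0 ∎
    where
    open ≤-Reasoning
    c : ℕ
    c = a * 2 ^ k + k
  scaledPow≤polyBound a k (suc n) = begin
    a * (2 + n) ^ k          ≤⟨ *-monoʳ-≤ a (^-monoˡ-≤ k 2+n≤2[1+n]) ⟩
    a * (2 * suc n) ^ k      ≡⟨ cong (a *_) (^-distribʳ-* 2 (suc n) k) ⟩
    a * (2 ^ k * suc n ^ k)  ≡⟨ *-assoc a (2 ^ k) (suc n ^ k) ⟨
    a * 2 ^ k * suc n ^ k    ≤⟨ *-mono-≤ (m≤m+n (a * 2 ^ k) k) (^-monoʳ-≤ (suc n) (m≤n+m k (a * 2 ^ k))) ⟩
    c * suc n ^ c            ≤⟨ m≤m+n (c * suc n ^ c) c ⟩
    polyBound c (suc n) ∎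
    where
    open ≤-Reasoning
    c : ℕ
    c = a * 2 ^ k + k
    2+n≤2[1+n] : 2 + n ≤ 2 * suc n
    2+n≤2[1+n] = ≤-trans (+-monoʳ-≤ 2 (m≤n*m n 2)) (≤-reflexive (sym (*-suc 2 n)))

  polyBound-mono : ∀ e {x y} → x ≤ y → polyBound e x ≤ polyBound e y
  polyBound-mono e le = +-monoˡ-≤ e (*-monoʳ-≤ e (^-monoˡ-≤ e le))

  polyBound-∘ : ∀ {p} → PolyBounded p → ∀ e → ∃ λ a → ∃ λ k → ∀ n → polyBound e (p n) ≤ scaledPow a k n
  polyBound-∘ {p} (c , p≤) e = (e + e) * suc (c + c) ^ e , c * e , λ n → begin
    polyBound e (p n)                            ≤⟨ polyBound-mono e (p≤ n) ⟩
    polyBound e (polyBound c n)                  ≤⟨ polyBound≤scaledPow e (polyBound c n) ⟩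
    (e + e) * suc (polyBound c n) ^ e            ≤⟨ *-monoʳ-≤ (e + e) (^-≤scaledPow (suc (c + c)) c n e
                                                      (suc-≤scaledPow (c + c) c n (polyBound≤scaledPow c n))) ⟩
    (e + e) * (suc (c + c) ^ e * suc n ^ (c * e)) ≡⟨ *-assoc (e + e) (suc (c + c) ^ e) (suc n ^ (c * e)) ⟨
    scaledPow ((e + e) * suc (c + c) ^ e) (c * e) n ∎
    where open ≤-Reasoning

  -- The size blow-up of both translations: each of the S gates / vertices of a
  -- model for g(p n) is replaced by at most 2·(q n + 1)^3 new ones, plus two.
  translation-polyBounded : ∀ {p q} → PolyBounded p → PolyBounded q → ∀ e →
    ∃ λ e' → ∀ n S → S ≤ polyBound e (p n) → S * (suc (q n) ^ 3 * 2) + 2 ≤ polyBound e' n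
  translation-polyBounded {p} {q} pPoly (c , q≤) e with polyBound-∘ pPoly e
  ... | a , k , S≤ = (a * (b * 2) + 2) * 2 ^ K + K , λ n S le →
    ≤-trans (+-≤scaledPow (a * (b * 2)) 2 K n
              (*-≤scaledPow a (b * 2) k (c * 3 + 0) n (≤-trans le (S≤ n))
                (*-≤scaledPow b 2 (c * 3) 0 n (cube≤ n) (≤scaledPow 2 0 n)))
              (≤scaledPow 2 K n))
            (scaledPow≤polyBound (a * (b * 2) + 2) K n)
    where
    b K : ℕ
    b = suc (c + c) ^ 3
    K = k + (c * 3 + 0)
    cube≤ : ∀ n → suc (q n) ^ 3 ≤ scaledPow b (c * 3) n
    cube≤ n = ^-≤scaledPow (suc (c + c)) c n 3
                (suc-≤scaledPow (c + c) c n (≤-trans (q≤ n) (polyBound≤scaledPow c n)))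

module VecIndexing where

  open import Data.Nat using (ℕ; zero; suc; _≤_; _<_; s≤s)
  open import Data.Fin using (Fin; zero; suc; inject₁; fromℕ)
  open import Data.Vec using (Vec; []; _∷_; _∷ʳ_; lookup)
  open import Data.Product using (Σ-syntax; _,_)
  open import Data.Sum using (_⊎_; inj₁; inj₂)
  open import Relation.Binary.PropositionalEquality

  private variable
    a : Level.Level
    A : Set a
    k : ℕ

  lookup-∷ʳ-inject₁ : (xs : Vec A k) (x : A) (i : Fin k) → lookup (xs ∷ʳ x) (inject₁ i) ≡ lookup xs i
  lookup-∷ʳ-inject₁ (y ∷ xs) x zero    = refl
  lookup-∷ʳ-inject₁ (y ∷ xs) x (suc i) = lookup-∷ʳ-inject₁ xs x i

  lookup-∷ʳ-fromℕ : (xs : Vec A k) (x : A) → lookup (xs ∷ʳ x) (fromℕ k) ≡ x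
  lookup-∷ʳ-fromℕ []       x = refl
  lookup-∷ʳ-fromℕ (y ∷ xs) x = lookup-∷ʳ-fromℕ xs x

  inject₁-or-fromℕ : (i : Fin (suc k)) → (Σ[ j ∈ Fin k ] i ≡ inject₁ j) ⊎ (i ≡ fromℕ k)
  inject₁-or-fromℕ {zero}  zero    = inj₂ refl
  inject₁-or-fromℕ {suc k} zero    = inj₁ (zero , refl)
  inject₁-or-fromℕ {suc k} (suc i) with inject₁-or-fromℕ i
  ... | inj₁ (j , eq) = inj₁ (suc j , cong suc eq)
  ... | inj₂ eq       = inj₂ (cong suc eq)

  lookupℕ : Vec A k → ℕ → A → A
  lookupℕ []       i       d = d
  lookupℕ (x ∷ xs) zero    d = x
  lookupℕ (x ∷ xs) (suc i) d = lookupℕ xs i d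

  lookupℕ-∷ʳ-< : (xs : Vec A k) (x : A) → ∀ i d → i < k → lookupℕ (xs ∷ʳ x) i d ≡ lookupℕ xs i d
  lookupℕ-∷ʳ-< (y ∷ xs) x zero    d i<k       = refl
  lookupℕ-∷ʳ-< (y ∷ xs) x (suc i) d (s≤s i<k) = lookupℕ-∷ʳ-< xs x i d i<k

  lookupℕ-∷ʳ-length : (xs : Vec A k) (x : A) → ∀ d → lookupℕ (xs ∷ʳ x) k d ≡ x
  lookupℕ-∷ʳ-length []       x d = refl
  lookupℕ-∷ʳ-length (y ∷ xs) x d = lookupℕ-∷ʳ-length xs x d

  clampFin : ∀ k → ℕ → Fin (suc k)
  clampFin zero    i       = zero
  clampFin (suc k) zero    = zero
  clampFin (suc k) (suc i) = suc (clampFin k i)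

  lookup-clampFin : (xs : Vec A (suc k)) → ∀ i d → i ≤ k → lookup xs (clampFin k i) ≡ lookupℕ xs i d
  lookup-clampFin {k = zero}  (x ∷ [])  zero   d i≤k       = refl
  lookup-clampFin {k = suc k} (x ∷ xs) zero    d i≤k       = refl
  lookup-clampFin {k = suc k} (x ∷ xs) (suc i) d (s≤s i≤k) = lookup-clampFin xs i d i≤k
module SeriesAlgebra {c ℓ} (F : Field c ℓ) where

  open import Level using (_⊔_)
  open import Data.Nat using (ℕ; zero; suc; _≤_; _<_; _≤?_; z≤n; s≤s; _^_)
    renaming (_⊔_ to _⊔ℕ_; _+_ to _+ℕ_; _*_ to _*ℕ_; _∸_ to _∸ℕ_)
  import Data.Nat.Properties as NP
  open import Data.Fin using (Fin; zero; suc; _↑ˡ_; _↑ʳ_; combine; remQuot; fromℕ)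
  open import Data.Fin.Properties using (remQuot-combine; suc-injective) renaming (_≟_ to _≟ᶠ_)
  open import Data.List using (List; []; _∷_; length; map; foldr; _++_; concat; tabulate; applyUpTo)
    renaming (allFin to allFinL; upTo to upToL)
  import Data.List.Properties as LP
  open import Data.Product using (Σ; _×_; _,_; proj₁; proj₂)
  open import Function using (_∘_)
  open import Data.Empty using (⊥-elim)
  open import Relation.Nullary using (¬_; yes; no)
  import Relation.Binary.PropositionalEquality as P
  open Field F hiding (zero)
  open NC F
  open import Relation.Binary.Reasoning.Setoid setoid
  open import Algebra.Properties.CommutativeSemigroup +-commutativeSemigroup using () renaming (interchange to +-interchange)
  open import Algebra.Properties.CommutativeSemigroup *-commutativeSemigroup using () renaming (interchange to *-interchange)

  record IsLinear {a} {A : Set a} (L : (A → Carrier) → Carrier) : Set (a ⊔ c ⊔ ℓ) where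
    field
      lin-cong : ∀ {f g} → (∀ x → f x ≈ g x) → L f ≈ L g
      lin-+  : ∀ f g → L (λ x → f x + g x) ≈ L f + L g
      lin-0 : ∀ f → (∀ x → f x ≈ 0#) → L f ≈ 0#
      lin-* : ∀ k f → k * L f ≈ L (λ x → k * f x)

  open IsLinear public

  lin-*ʳ : ∀ {a} {A : Set a} {L} → IsLinear {A = A} L → ∀ k f → L f * k ≈ L (λ x → f x * k)
  lin-*ʳ {L = L} lin k f = begin
    L f * k ≈⟨ *-comm _ _ ⟩
    k * L f ≈⟨ lin-* lin k f ⟩
    L (λ x → k * f x) ≈⟨ lin-cong lin (λ x → *-comm _ _) ⟩
    L (λ x → f x * k) ∎

  IsLinear-Σ : ∀ {a b} {A : Set a} {B : A → Set b} {L1} {L2 : (x : A) → (B x → Carrier) → Carrier} →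
    IsLinear {A = A} L1 → (∀ x → IsLinear (L2 x)) → IsLinear {A = Σ A B} (λ f → L1 (λ x → L2 x (λ y → f (x , y))))
  lin-cong (IsLinear-Σ l1 l2) e = lin-cong l1 (λ x → lin-cong (l2 x) (λ y → e (x , y)))
  lin-+ (IsLinear-Σ l1 l2) f g = trans (lin-cong l1 (λ x → lin-+ (l2 x) _ _)) (lin-+ l1 _ _)
  lin-0 (IsLinear-Σ l1 l2) f e = lin-0 l1 _ (λ x → lin-0 (l2 x) _ (λ y → e (x , y)))
  lin-* (IsLinear-Σ l1 l2) k f = trans (lin-* l1 k _) (lin-cong l1 (λ x → lin-* (l2 x) k _))

  IsLinear-∘ : ∀ {a b} {A : Set a} {B : Set b} {L} → IsLinear {A = A} L → (π : A → B) → IsLinear {A = B} (λ f → L (λ x → f (π x)))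
  lin-cong (IsLinear-∘ l π) e = lin-cong l (λ x → e (π x))
  lin-+ (IsLinear-∘ l π) f g = lin-+ l _ _
  lin-0 (IsLinear-∘ l π) f e = lin-0 l _ (λ x → e (π x))
  lin-* (IsLinear-∘ l π) k f = lin-* l k _

  sumFin-linear : ∀ k → IsLinear (sumFin k)
  lin-cong (sumFin-linear zero) e = refl
  lin-cong (sumFin-linear (suc k)) e = +-cong (e zero) (lin-cong (sumFin-linear k) (λ i → e (suc i)))
  lin-+ (sumFin-linear zero) f g = (sym (+-identityʳ 0#))
  lin-+ (sumFin-linear (suc k)) f g = begin
    (f zero + g zero) + sumFin k (λ i → f (suc i) + g (suc i))
      ≈⟨ +-congˡ (lin-+ (sumFin-linear k) _ _) ⟩
    (f zero + g zero) + (sumFin k (λ i → f (suc i)) + sumFin k (λ i → g (suc i)))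
      ≈⟨ +-interchange _ _ _ _ ⟩
    _ ∎
  lin-0 (sumFin-linear zero) f e = refl
  lin-0 (sumFin-linear (suc k)) f e = trans (+-cong (e zero) (lin-0 (sumFin-linear k) _ (λ i → e (suc i)))) (+-identityʳ 0#)
  lin-* (sumFin-linear zero) k f = zeroʳ k
  lin-* (sumFin-linear (suc n)) k f = trans (distribˡ k _ _) (+-congˡ (lin-* (sumFin-linear n) k _))

  sumFin-swap : ∀ {b} {B : Set b} {L} → IsLinear {A = B} L → ∀ k (h : Fin k → B → Carrier) →
            sumFin k (λ i → L (h i)) ≈ L (λ x → sumFin k (λ i → h i x))
  sumFin-swap lin zero h = sym (lin-0 lin _ (λ x → refl))
  sumFin-swap {L = L} lin (suc k) h = begin
    L (h zero) + sumFin k (λ i → L (h (suc i))) ≈⟨ +-congˡ (sumFin-swap lin k _) ⟩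
    L (h zero) + L (λ x → sumFin k (λ i → h (suc i) x)) ≈⟨ sym (lin-+ lin _ _) ⟩
    _ ∎

  sumFin-single : ∀ k (i0 : Fin k) (h : Fin k → Carrier) → (∀ i → ¬ (i0 P.≡ i) → h i ≈ 0#) → sumFin k h ≈ h i0
  sumFin-single (suc k) zero h e = trans (+-congˡ (lin-0 (sumFin-linear k) _ (λ i → e (suc i) (λ ())))) (+-identityʳ _)
  sumFin-single (suc k) (suc i0) h e = trans (+-congʳ (e zero (λ ()))) (trans (+-identityˡ _)
     (sumFin-single k i0 _ (λ i ne → e (suc i) (λ eq → ne (suc-injective eq)))))

  sumFin-↑ : ∀ a b (h : Fin (a +ℕ b) → Carrier) → sumFin (a +ℕ b) h ≈ sumFin a (λ i → h (i ↑ˡ b)) + sumFin b (λ j → h (a ↑ʳ j))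
  sumFin-↑ zero b h = sym (+-identityˡ _)
  sumFin-↑ (suc a) b h = trans (+-congˡ (sumFin-↑ a b _)) (sym (+-assoc _ _ _))

  sumFin-combine : ∀ w Q (h : Fin (w *ℕ Q) → Carrier) → sumFin (w *ℕ Q) h ≈ sumFin w (λ v → sumFin Q (λ k → h (combine v k)))
  sumFin-combine zero Q h = refl
  sumFin-combine (suc w) Q h = trans (sumFin-↑ Q (w *ℕ Q) h) (+-congˡ (sumFin-combine w Q _))

  sumOver : ∀ {a} {A : Set a} → List A → (A → Carrier) → Carrier
  sumOver xs h = sumL (map h xs)

  sumOver-linear : ∀ {a} {A : Set a} (xs : List A) → IsLinear (sumOver xs)
  lin-cong (sumOver-linear []) e = refl
  lin-cong (sumOver-linear (x ∷ xs)) e = +-cong (e x) (lin-cong (sumOver-linear xs) e)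
  lin-+ (sumOver-linear []) f g = (sym (+-identityʳ 0#))
  lin-+ (sumOver-linear (x ∷ xs)) f g = trans (+-congˡ (lin-+ (sumOver-linear xs) f g)) (+-interchange _ _ _ _)
  lin-0 (sumOver-linear []) f e = refl
  lin-0 (sumOver-linear (x ∷ xs)) f e = trans (+-cong (e x) (lin-0 (sumOver-linear xs) f e)) (+-identityʳ 0#)
  lin-* (sumOver-linear []) k f = zeroʳ k
  lin-* (sumOver-linear (x ∷ xs)) k f = trans (distribˡ k _ _) (+-congˡ (lin-* (sumOver-linear xs) k f))

  sumOver-swap : ∀ {a b} {A : Set a} {B : Set b} {L} → IsLinear {A = B} L → (xs : List A) (h : A → B → Carrier) →
            sumOver xs (λ i → L (h i)) ≈ L (λ x → sumOver xs (λ i → h i x))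
  sumOver-swap lin [] h = sym (lin-0 lin _ (λ x → refl))
  sumOver-swap lin (y ∷ xs) h = trans (+-congˡ (sumOver-swap lin xs h)) (sym (lin-+ lin _ _))

  sumOver-map : ∀ {a b} {A : Set a} {B : Set b} (g : A → B) (h : B → Carrier) xs →
           sumOver (map g xs) h P.≡ sumOver xs (λ x → h (g x))
  sumOver-map g h xs = P.cong sumL (P.sym (LP.map-∘ xs))

  sumOver-++ : ∀ {a} {A : Set a} (xs ys : List A) (h : A → Carrier) → sumOver (xs ++ ys) h ≈ sumOver xs h + sumOver ys h
  sumOver-++ [] ys h = sym (+-identityˡ _)
  sumOver-++ (x ∷ xs) ys h = trans (+-congˡ (sumOver-++ xs ys h)) (sym (+-assoc _ _ _))

  sumOver-concat : ∀ {a} {A : Set a} (xss : List (List A)) (h : A → Carrier) → sumOver (concat xss) h ≈ sumOver xss (λ xs → sumOver xs h)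
  sumOver-concat [] h = refl
  sumOver-concat (xs ∷ xss) h = trans (sumOver-++ xs _ h) (+-congˡ (sumOver-concat xss h))

  sumOver-tabulate : ∀ k {a} {A : Set a} (f : Fin k → A) (G : A → Carrier) → sumOver (tabulate f) G ≈ sumFin k (λ i → G (f i))
  sumOver-tabulate zero f G = refl
  sumOver-tabulate (suc k) f G = +-congˡ (sumOver-tabulate k _ G)

  sumLen : ∀ {m} → ℕ → (Word m → Carrier) → Carrier
  sumLen zero h = h []
  sumLen {m} (suc k) h = sumFin m (λ i → sumLen k (λ w → h (i ∷ w)))

  sumLen-linear : ∀ {m} k → IsLinear (sumLen {m} k)
  lin-cong (sumLen-linear zero) e = e []
  lin-cong (sumLen-linear {m} (suc k)) e = lin-cong (sumFin-linear m) (λ i → lin-cong (sumLen-linear k) (λ w → e (i ∷ w)))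
  lin-+ (sumLen-linear zero) f g = refl
  lin-+ (sumLen-linear {m} (suc k)) f g = trans (lin-cong (sumFin-linear m) (λ i → lin-+ (sumLen-linear k) _ _)) (lin-+ (sumFin-linear m) _ _)
  lin-0 (sumLen-linear zero) f e = e []
  lin-0 (sumLen-linear {m} (suc k)) f e = lin-0 (sumFin-linear m) _ (λ i → lin-0 (sumLen-linear k) _ (λ w → e (i ∷ w)))
  lin-* (sumLen-linear zero) k f = refl
  lin-* (sumLen-linear {m} (suc n)) k f = trans (lin-* (sumFin-linear m) k _) (lin-cong (sumFin-linear m) (λ i → lin-* (sumLen-linear n) k _))

  sumLen-swap : ∀ {m b} {B : Set b} {L} → IsLinear {A = B} L → ∀ k (h : Word m → B → Carrier) →
            sumLen k (λ w → L (h w)) ≈ L (λ x → sumLen k (λ w → h w x))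
  sumLen-swap lin zero h = refl
  sumLen-swap {m} lin (suc k) h = trans (lin-cong (sumFin-linear m) (λ i → sumLen-swap lin k _)) (sumFin-swap lin m _)

  sumLen-cong : ∀ {m} k {f g : Word m → Carrier} → (∀ w → length w P.≡ k → f w ≈ g w) → sumLen k f ≈ sumLen k g
  sumLen-cong zero e = e [] P.refl
  sumLen-cong {m} (suc k) e = lin-cong (sumFin-linear m) (λ i → sumLen-cong k (λ w eq → e (i ∷ w) (P.cong suc eq)))

  sumLen-0 : ∀ {m} k (f : Word m → Carrier) → (∀ w → length w P.≡ k → f w ≈ 0#) → sumLen k f ≈ 0#
  sumLen-0 k f e = trans (sumLen-cong k {g = λ _ → 0#} e) (lin-0 (sumLen-linear k) _ (λ _ → refl))

  sumOver-wordsOf : ∀ m k (h : Word m → Carrier) → sumOver (wordsOf m k) h ≈ sumLen k h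
  sumOver-wordsOf m zero h = +-identityʳ _
  sumOver-wordsOf m (suc k) h = begin
    sumOver (concat (map (λ i → map (i ∷_) (wordsOf m k)) (allFinL m))) h
      ≈⟨ sumOver-concat (map (λ i → map (i ∷_) (wordsOf m k)) (allFinL m)) h ⟩
    sumOver (map (λ i → map (i ∷_) (wordsOf m k)) (allFinL m)) (λ xs → sumOver xs h)
      ≡⟨ sumOver-map _ _ (allFinL m) ⟩
    sumOver (allFinL m) (λ i → sumOver (map (i ∷_) (wordsOf m k)) h)
      ≈⟨ sumOver-tabulate m _ _ ⟩
    sumFin m (λ i → sumOver (map (i ∷_) (wordsOf m k)) h)
      ≈⟨ lin-cong (sumFin-linear m) (λ i → trans (reflexive (sumOver-map _ h (wordsOf m k))) (sumOver-wordsOf m k _)) ⟩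
    sumLen (suc k) h ∎

  sumUpTo : ℕ → (ℕ → Carrier) → Carrier
  sumUpTo zero g = g 0
  sumUpTo (suc D) g = g 0 + sumUpTo D (λ d → g (suc d))

  sumUpTo-linear : ∀ D → IsLinear (sumUpTo D)
  lin-cong (sumUpTo-linear zero) e = e 0
  lin-cong (sumUpTo-linear (suc D)) e = +-cong (e 0) (lin-cong (sumUpTo-linear D) (λ d → e (suc d)))
  lin-+ (sumUpTo-linear zero) f g = refl
  lin-+ (sumUpTo-linear (suc D)) f g = trans (+-congˡ (lin-+ (sumUpTo-linear D) _ _)) (+-interchange _ _ _ _)
  lin-0 (sumUpTo-linear zero) f e = e 0
  lin-0 (sumUpTo-linear (suc D)) f e = trans (+-cong (e 0) (lin-0 (sumUpTo-linear D) _ (λ d → e (suc d)))) (+-identityʳ 0#)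
  lin-* (sumUpTo-linear zero) k f = refl
  lin-* (sumUpTo-linear (suc D)) k f = trans (distribˡ k _ _) (+-congˡ (lin-* (sumUpTo-linear D) k _))

  sumUpTo-swap : ∀ {b} {B : Set b} {L} → IsLinear {A = B} L → ∀ D (h : ℕ → B → Carrier) →
            sumUpTo D (λ d → L (h d)) ≈ L (λ x → sumUpTo D (λ d → h d x))
  sumUpTo-swap lin zero h = refl
  sumUpTo-swap lin (suc D) h = trans (+-congˡ (sumUpTo-swap lin D _)) (sym (lin-+ lin _ _))

  sumUpTo-cong : ∀ D {f g : ℕ → Carrier} → (∀ d → d ≤ D → f d ≈ g d) → sumUpTo D f ≈ sumUpTo D g
  sumUpTo-cong zero e = e 0 z≤n
  sumUpTo-cong (suc D) e = +-cong (e 0 z≤n) (sumUpTo-cong D (λ d le → e (suc d) (s≤s le)))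

  sumUpTo-extend-+ : ∀ A k (g : ℕ → Carrier) → (∀ d → A < d → g d ≈ 0#) → sumUpTo (A +ℕ k) g ≈ sumUpTo A g
  sumUpTo-extend-+ zero zero g e = refl
  sumUpTo-extend-+ zero (suc k) g e = trans (+-congˡ (lin-0 (sumUpTo-linear k) _ (λ d → e (suc d) (s≤s z≤n)))) (+-identityʳ _)
  sumUpTo-extend-+ (suc A) k g e = +-congˡ (sumUpTo-extend-+ A k _ (λ d lt → e (suc d) (s≤s lt)))

  sumUpTo-triangle : ∀ D (X : ℕ → ℕ → Carrier) →
           sumUpTo D (λ d → sumUpTo d (λ j → X j (d ∸ℕ j))) ≈ sumUpTo D (λ j → sumUpTo (D ∸ℕ j) (X j))
  sumUpTo-triangle zero X = refl
  sumUpTo-triangle (suc D) X = begin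
    X 0 0 + sumUpTo D (λ d → X 0 (suc d) + sumUpTo d (λ j → X (suc j) (d ∸ℕ j)))
      ≈⟨ +-congˡ (lin-+ (sumUpTo-linear D) _ _) ⟩
    X 0 0 + (sumUpTo D (λ d → X 0 (suc d)) + sumUpTo D (λ d → sumUpTo d (λ j → X (suc j) (d ∸ℕ j))))
      ≈⟨ +-congˡ (+-congˡ (sumUpTo-triangle D (λ j → X (suc j)))) ⟩
    X 0 0 + (sumUpTo D (λ d → X 0 (suc d)) + sumUpTo D (λ j → sumUpTo (D ∸ℕ j) (X (suc j))))
      ≈⟨ sym (+-assoc _ _ _) ⟩
    _ ∎

  sumUpTo-extend : ∀ A B (g : ℕ → Carrier) → A ≤ B → (∀ d → A < d → g d ≈ 0#) → sumUpTo B g ≈ sumUpTo A g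
  sumUpTo-extend A B g le e =
    trans (reflexive (P.cong (λ z → sumUpTo z g) (P.sym (NP.m+[n∸m]≡n le)))) (sumUpTo-extend-+ A (B ∸ℕ A) g e)

  sumUpTo-triangle≈box : ∀ D1 D2 (X : ℕ → ℕ → Carrier) →
    (∀ j l → D1 < j → X j l ≈ 0#) → (∀ j l → D2 < l → X j l ≈ 0#) →
    sumUpTo (D1 +ℕ D2) (λ j → sumUpTo (D1 +ℕ D2 ∸ℕ j) (X j)) ≈ sumUpTo D1 (λ j → sumUpTo D2 (X j))
  sumUpTo-triangle≈box D1 D2 X e1 e2 = trans
    (sumUpTo-extend-+ D1 D2 _ (λ d lt → lin-0 (sumUpTo-linear (D1 +ℕ D2 ∸ℕ d)) _ (λ l → e1 d l lt)))
    (sumUpTo-cong D1 (λ j le → sumUpTo-extend D2 (D1 +ℕ D2 ∸ℕ j) (X j) (D2≤ j le) (λ l lt → e2 j l lt)))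
    where
    D2≤ : ∀ j → j ≤ D1 → D2 ≤ D1 +ℕ D2 ∸ℕ j
    D2≤ j le rewrite NP.+-comm D1 D2 | NP.+-∸-assoc D2 le = NP.m≤m+n D2 (D1 ∸ℕ j)

  sumOver-applyUpTo : ∀ D (f : ℕ → ℕ) (G : ℕ → Carrier) → sumOver (applyUpTo f (suc D)) G ≈ sumUpTo D (λ d → G (f d))
  sumOver-applyUpTo zero f G = +-identityʳ _
  sumOver-applyUpTo (suc D) f G = +-congˡ (sumOver-applyUpTo D (λ d → f (suc d)) G)

  sumOver-wordsUpTo : ∀ m D (h : Word m → Carrier) → sumOver (wordsUpTo m D) h ≈ sumUpTo D (λ d → sumLen d h)
  sumOver-wordsUpTo m D h = begin
    sumOver (concat (map (wordsOf m) (upToL (suc D)))) h ≈⟨ sumOver-concat (map (wordsOf m) (upToL (suc D))) h ⟩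
    sumOver (map (wordsOf m) (upToL (suc D))) (λ xs → sumOver xs h) ≡⟨ sumOver-map _ _ (upToL (suc D)) ⟩
    sumOver (upToL (suc D)) (λ k → sumOver (wordsOf m k) h) ≈⟨ sumOver-applyUpTo D (λ d → d) _ ⟩
    sumUpTo D (λ d → sumOver (wordsOf m d) h) ≈⟨ lin-cong (sumUpTo-linear D) (λ d → sumOver-wordsOf m d h) ⟩
    sumUpTo D (λ d → sumLen d h) ∎

  sumOver-splits-++ : ∀ {a} {A : Set a} (w : List A) (H : List A → List A → List A → Carrier) →
     sumOver (splits w) (λ p → H (proj₁ p) (proj₂ p) (proj₁ p ++ proj₂ p)) P.≡ sumOver (splits w) (λ p → H (proj₁ p) (proj₂ p) w)
  sumOver-splits-++ [] H = P.refl
  sumOver-splits-++ (x ∷ w) H = P.cong (H [] (x ∷ w) (x ∷ w) +_)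
    (P.trans (sumOver-map _ _ (splits w))
      (P.trans (sumOver-splits-++ w (λ u v w' → H (x ∷ u) v (x ∷ w')))
        (P.sym (sumOver-map _ _ (splits w)))))

  sumOver-splits-0 : ∀ {a} {A : Set a} (w : List A) (H : List A → List A → Carrier) →
     (∀ u v → length u +ℕ length v P.≡ length w → H u v ≈ 0#) →
     sumOver (splits w) (λ p → H (proj₁ p) (proj₂ p)) ≈ 0#
  sumOver-splits-0 [] H e = trans (+-identityʳ _) (e [] [] P.refl)
  sumOver-splits-0 (x ∷ w) H e = trans (+-cong (e [] (x ∷ w) P.refl)
      (trans (reflexive (sumOver-map _ _ (splits w)))
             (sumOver-splits-0 w (λ u v → H (x ∷ u) v) (λ u v eq → e (x ∷ u) v (P.cong suc eq)))))
      (+-identityʳ 0#)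

  sumLen-splits : ∀ {m} k (h : Word m × Word m → Carrier) →
    sumLen k (λ w → sumOver (splits w) h) ≈ sumUpTo k (λ j → sumLen j (λ u → sumLen (k ∸ℕ j) (λ v → h (u , v))))
  sumLen-splits zero h = +-identityʳ _
  sumLen-splits {m} (suc k) h = begin
    sumFin m (λ i → sumLen k (λ w → h ([] , i ∷ w) + sumOver (map _ (splits w)) h))
      ≈⟨ lin-cong (sumFin-linear m) (λ i → lin-cong (sumLen-linear k) (λ w → +-congˡ (reflexive (sumOver-map _ h (splits w))))) ⟩
    sumFin m (λ i → sumLen k (λ w → h ([] , i ∷ w) + sumOver (splits w) (λ p → h (i ∷ proj₁ p , proj₂ p))))
      ≈⟨ lin-cong (sumFin-linear m) (λ i → lin-+ (sumLen-linear k) _ _) ⟩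
    sumFin m (λ i → sumLen k (λ w → h ([] , i ∷ w)) + sumLen k (λ w → sumOver (splits w) (λ p → h (i ∷ proj₁ p , proj₂ p))))
      ≈⟨ lin-+ (sumFin-linear m) _ _ ⟩
    sumLen (suc k) (λ w → h ([] , w)) + sumFin m (λ i → sumLen k (λ w → sumOver (splits w) (λ p → h (i ∷ proj₁ p , proj₂ p))))
      ≈⟨ +-congˡ (lin-cong (sumFin-linear m) (λ i → sumLen-splits k (λ p → h (i ∷ proj₁ p , proj₂ p)))) ⟩
    sumLen (suc k) (λ w → h ([] , w)) + sumFin m (λ i → sumUpTo k (λ j → sumLen j (λ u → sumLen (k ∸ℕ j) (λ v → h (i ∷ u , v)))))
      ≈⟨ +-congˡ (sumFin-swap (sumUpTo-linear k) m _) ⟩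
    sumLen (suc k) (λ w → h ([] , w)) + sumUpTo k (λ j → sumFin m (λ i → sumLen j (λ u → sumLen (k ∸ℕ j) (λ v → h (i ∷ u , v)))))
      ∎

  module SeriesLaws {n : ℕ} where
    *ₛ-cong : ∀ {a a' b b' : Series n} → a ≈ₛ a' → b ≈ₛ b' → (a *ₛ b) ≈ₛ (a' *ₛ b')
    *ₛ-cong ea eb w = lin-cong (sumOver-linear (splits w)) (λ p → *-cong (ea (proj₁ p)) (eb (proj₂ p)))

    *ₛ-cons : ∀ (a b : Series n) x w → (a *ₛ b) (x ∷ w) P.≡ a [] * b (x ∷ w) + ((λ u → a (x ∷ u)) *ₛ b) w
    *ₛ-cons a b x w = P.cong (a [] * b (x ∷ w) +_) (sumOver-map _ _ (splits w))

    *ₛ-distribʳ : ∀ (s t d : Series n) w → ((s +ₛ t) *ₛ d) w ≈ (s *ₛ d) w + (t *ₛ d) w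
    *ₛ-distribʳ s t d w = trans (lin-cong (sumOver-linear (splits w)) (λ p → distribʳ _ _ _)) (lin-+ (sumOver-linear (splits w)) _ _)

    •ₛ-*ₛ : ∀ k (s t : Series n) w → ((k •ₛ s) *ₛ t) w ≈ k * (s *ₛ t) w
    •ₛ-*ₛ k s t w = sym (trans (lin-* (sumOver-linear (splits w)) k _) (lin-cong (sumOver-linear (splits w)) (λ p → sym (*-assoc _ _ _))))

    *ₛ-assoc : ∀ (a b d : Series n) w → ((a *ₛ b) *ₛ d) w ≈ (a *ₛ (b *ₛ d)) w
    *ₛ-assoc a b d [] = +-congʳ (trans (*-congʳ (+-identityʳ _)) (trans (*-assoc _ _ _) (*-congˡ (sym (+-identityʳ _)))))
    *ₛ-assoc a b d (x ∷ w) = begin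
      ((a *ₛ b) *ₛ d) (x ∷ w)
        ≡⟨ *ₛ-cons (a *ₛ b) d x w ⟩
      (a *ₛ b) [] * d (x ∷ w) + ((λ u → (a *ₛ b) (x ∷ u)) *ₛ d) w
        ≈⟨ +-congˡ (*ₛ-cong {b = d} (λ u → reflexive (*ₛ-cons a b x u)) (λ _ → refl) w) ⟩
      (a *ₛ b) [] * d (x ∷ w) + (((a [] •ₛ b') +ₛ (a' *ₛ b)) *ₛ d) w
        ≈⟨ +-congˡ (*ₛ-distribʳ _ _ d w) ⟩
      (a *ₛ b) [] * d (x ∷ w) + (((a [] •ₛ b') *ₛ d) w + ((a' *ₛ b) *ₛ d) w)
        ≈⟨ +-congˡ (+-cong (•ₛ-*ₛ (a []) b' d w) (*ₛ-assoc a' b d w)) ⟩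
      (a [] * b [] + 0#) * d (x ∷ w) + (a [] * (b' *ₛ d) w + (a' *ₛ (b *ₛ d)) w)
        ≈⟨ sym (+-assoc _ _ _) ⟩
      ((a [] * b [] + 0#) * d (x ∷ w) + a [] * (b' *ₛ d) w) + (a' *ₛ (b *ₛ d)) w
        ≈⟨ +-congʳ (+-congʳ (trans (*-congʳ (+-identityʳ _)) (*-assoc _ _ _))) ⟩
      (a [] * (b [] * d (x ∷ w)) + a [] * (b' *ₛ d) w) + (a' *ₛ (b *ₛ d)) w
        ≈⟨ +-congʳ (sym (distribˡ _ _ _)) ⟩
      a [] * (b [] * d (x ∷ w) + (b' *ₛ d) w) + (a' *ₛ (b *ₛ d)) w
        ≡⟨ P.cong (λ z → a [] * z + (a' *ₛ (b *ₛ d)) w) (P.sym (*ₛ-cons b d x w)) ⟩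
      a [] * (b *ₛ d) (x ∷ w) + (a' *ₛ (b *ₛ d)) w
        ≡⟨ P.sym (*ₛ-cons a (b *ₛ d) x w) ⟩
      (a *ₛ (b *ₛ d)) (x ∷ w) ∎
      where
      a' b' : Series n
      a' u = a (x ∷ u)
      b' u = b (x ∷ u)

    constₛ-*ₛ : ∀ k (a : Series n) w → (constₛ k *ₛ a) w ≈ k * a w
    constₛ-*ₛ k a [] = +-identityʳ _
    constₛ-*ₛ k a (x ∷ w) = trans (reflexive (*ₛ-cons (constₛ k) a x w))
      (trans (+-congˡ (lin-0 (sumOver-linear (splits w)) _ (λ p → zeroˡ _))) (+-identityʳ _))

    *ₛ-constₛ : ∀ k (a : Series n) w → (a *ₛ constₛ k) w ≈ k * a w
    *ₛ-constₛ k a [] = trans (+-identityʳ _) (*-comm _ _)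
    *ₛ-constₛ k a (x ∷ w) = trans (reflexive (*ₛ-cons a (constₛ k) x w))
      (trans (+-cong (zeroʳ _) (*ₛ-constₛ k (λ u → a (x ∷ u)) w)) (+-identityˡ _))

    0ₛ-*ₛ : ∀ (a : Series n) w → (0ₛ *ₛ a) w ≈ 0#
    0ₛ-*ₛ a w = lin-0 (sumOver-linear (splits w)) _ (λ p → zeroˡ _)

    *ₛ-0ₛ : ∀ (a : Series n) w → (a *ₛ 0ₛ) w ≈ 0#
    *ₛ-0ₛ a w = lin-0 (sumOver-linear (splits w)) _ (λ p → zeroʳ _)

    sumFinₛ-*ₛ : ∀ k (h : Fin k → Series n) (d : Series n) w →
      (sumFinₛ k h *ₛ d) w ≈ sumFin k (λ i → (h i *ₛ d) w)
    sumFinₛ-*ₛ k h d w = trans (lin-cong (sumOver-linear (splits w)) (λ p → lin-*ʳ (sumFin-linear k) _ _))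
                            (sym (sumFin-swap (sumOver-linear (splits w)) k _))

    *ₛ-sumFinₛ : ∀ k (h : Fin k → Series n) (d : Series n) w →
      (d *ₛ sumFinₛ k h) w ≈ sumFin k (λ i → (d *ₛ h i) w)
    *ₛ-sumFinₛ k h d w = trans (lin-cong (sumOver-linear (splits w)) (λ p → lin-* (sumFin-linear k) _ _))
                            (sym (sumFin-swap (sumOver-linear (splits w)) k _))

  Deg≤ : ∀ {m} → ℕ → Series m → Set ℓ
  Deg≤ D s = ∀ w → D < length w → s w ≈ 0#

  Deg≤-mono : ∀ {m D D'} {s : Series m} → Deg≤ D s → D ≤ D' → Deg≤ D' s
  Deg≤-mono v le w lt = v w (NP.≤-<-trans le lt)

  Deg≤-constₛ : ∀ {m} a → Deg≤ {m} 0 (constₛ a)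
  Deg≤-constₛ a (x ∷ w) lt = refl

  Deg≤-varₛ : ∀ {m} (y : Fin m) → Deg≤ 1 (varₛ y)
  Deg≤-varₛ y (a ∷ b ∷ w) lt = refl
  Deg≤-varₛ y (a ∷ []) (s≤s ())

  Deg≤-+ₛ : ∀ {m D} {s t : Series m} → Deg≤ D s → Deg≤ D t → Deg≤ D (s +ₛ t)
  Deg≤-+ₛ vs vt w lt = trans (+-cong (vs w lt) (vt w lt)) (+-identityʳ _)

  Deg≤-•ₛ : ∀ {m D} k {s : Series m} → Deg≤ D s → Deg≤ D (k •ₛ s)
  Deg≤-•ₛ k vs w lt = trans (*-congˡ (vs w lt)) (zeroʳ _)

  Deg≤-sumFinₛ : ∀ {m D} k {h : Fin k → Series m} → (∀ i → Deg≤ D (h i)) → Deg≤ D (sumFinₛ k h)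
  Deg≤-sumFinₛ k vh w lt = lin-0 (sumFin-linear k) _ (λ i → vh i w lt)

  Deg≤-*ₛ : ∀ {m} D1 D2 {s t : Series m} → Deg≤ D1 s → Deg≤ D2 t → Deg≤ (D1 +ℕ D2) (s *ₛ t)
  Deg≤-*ₛ D1 D2 {s} {t} vs vt w lt = sumOver-splits-0 w (λ u v → s u * t v) product-vanishes
    where
    product-vanishes : ∀ u v → length u +ℕ length v P.≡ length w → s u * t v ≈ 0#
    product-vanishes u v eq with length u ≤? D1 | length v ≤? D2
    ... | yes a | yes b = ⊥-elim (NP.<-irrefl P.refl (NP.<-≤-trans lt (P.subst (_≤ D1 +ℕ D2) eq (NP.+-mono-≤ a b))))
    ... | no a | _ = trans (*-congʳ (vs u (NP.≰⇒> a))) (zeroˡ _)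
    ... | yes _ | no b = trans (*-congˡ (vt v (NP.≰⇒> b))) (zeroʳ _)

  Deg≤-linₛ : ∀ {m} (L : LinForm m) → Deg≤ 1 (linₛ L)
  Deg≤-linₛ {m} (a0 , a) = Deg≤-+ₛ (Deg≤-mono (Deg≤-constₛ a0) z≤n) (Deg≤-sumFinₛ m (λ i → Deg≤-•ₛ (a i) (Deg≤-varₛ i)))

  δ : ∀ {k} → Fin k → Fin k → Carrier
  δ i j with i ≟ᶠ j
  ... | yes _ = 1#
  ... | no _ = 0#

  δ-diag : ∀ {k} (i : Fin k) → δ i i P.≡ 1#
  δ-diag i with i ≟ᶠ i
  ... | yes _ = P.refl
  ... | no ne = ⊥-elim (ne P.refl)

  δ-offdiag : ∀ {k} (i j : Fin k) → ¬ (i P.≡ j) → δ i j P.≡ 0#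
  δ-offdiag i j ne with i ≟ᶠ j
  ... | yes eq = ⊥-elim (ne eq)
  ... | no _ = P.refl

  constₛ≈*1ₛ : ∀ {N} a (x : Word N) → constₛ a x ≈ a * 1ₛ x
  constₛ≈*1ₛ a [] = sym (*-identityʳ a)
  constₛ≈*1ₛ a (_ ∷ _) = sym (zeroʳ a)

  idM≈δ*1ₛ : ∀ {N Q} (k k' : Fin Q) (x : Word N) → idM {N} {Q} k k' x ≈ δ k k' * 1ₛ x
  idM≈δ*1ₛ k k' x with k ≟ᶠ k'
  ... | yes _ = sym (*-identityˡ _)
  ... | no _ = sym (zeroˡ _)

  constPart : ∀ {N} → Entry N → Carrier
  constPart (cst a) = a
  constPart (var _) = 0#

  varCoeff : ∀ {N} → Entry N → Fin N → Carrier
  varCoeff (cst _) l = 0#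
  varCoeff (var i) l = δ i l

  entryₛ-decompose : ∀ {N} (e : Entry N) x → entryₛ e x ≈ constPart e * 1ₛ x + sumFin N (λ l → varCoeff e l * varₛ l x)
  entryₛ-decompose {N} (cst a) x = trans (constₛ≈*1ₛ a x) (sym (trans (+-congˡ (lin-0 (sumFin-linear N) _ (λ l → zeroˡ _))) (+-identityʳ _)))
  entryₛ-decompose {N} (var i) x = sym (trans (+-cong (zeroˡ _) (sumFin-single N i _ (λ l ne → trans (*-congʳ (reflexive (δ-offdiag i l ne))) (zeroˡ _))))
    (trans (+-identityˡ _) (trans (*-congʳ (reflexive (δ-diag i))) (*-identityˡ _))))

  module MatrixLaws {n Q : ℕ} where
    open SeriesLaws {n}
    _≈M_ : Mat n Q → Mat n Q → Set ℓ
    A ≈M B = ∀ i j → A i j ≈ₛ B i j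
    infix 4 _≈M_

    ≈M-trans : ∀ {A B C} → A ≈M B → B ≈M C → A ≈M C
    ≈M-trans e1 e2 i j w = trans (e1 i j w) (e2 i j w)
    ≈M-sym : ∀ {A B} → A ≈M B → B ≈M A
    ≈M-sym e i j w = sym (e i j w)

    idM-diag : ∀ (i : Fin Q) → idM {n} {Q} i i P.≡ 1ₛ
    idM-diag i with i ≟ᶠ i
    ... | yes _ = P.refl
    ... | no ne = ⊥-elim (ne P.refl)

    idM-offdiag : ∀ (i j : Fin Q) → ¬ (i P.≡ j) → idM {n} {Q} i j P.≡ 0ₛ
    idM-offdiag i j ne with i ≟ᶠ j
    ... | yes eq = ⊥-elim (ne eq)
    ... | no _ = P.refl

    *M-cong : ∀ {A A' B B' : Mat n Q} → A ≈M A' → B ≈M B' → (A *M B) ≈M (A' *M B')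
    *M-cong ea eb i j w = lin-cong (sumFin-linear Q) (λ k → *ₛ-cong (ea i k) (eb k j) w)

    *M-assoc : ∀ (A B C : Mat n Q) → ((A *M B) *M C) ≈M (A *M (B *M C))
    *M-assoc A B C i j w = begin
      sumFin Q (λ l → (sumFinₛ Q (λ k → A i k *ₛ B k l) *ₛ C l j) w)
        ≈⟨ lin-cong (sumFin-linear Q) (λ l → sumFinₛ-*ₛ Q _ (C l j) w) ⟩
      sumFin Q (λ l → sumFin Q (λ k → ((A i k *ₛ B k l) *ₛ C l j) w))
        ≈⟨ lin-cong (sumFin-linear Q) (λ l → lin-cong (sumFin-linear Q) (λ k → *ₛ-assoc (A i k) (B k l) (C l j) w)) ⟩
      sumFin Q (λ l → sumFin Q (λ k → (A i k *ₛ (B k l *ₛ C l j)) w))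
        ≈⟨ sumFin-swap (sumFin-linear Q) Q _ ⟩
      sumFin Q (λ k → sumFin Q (λ l → (A i k *ₛ (B k l *ₛ C l j)) w))
        ≈⟨ lin-cong (sumFin-linear Q) (λ k → sym (*ₛ-sumFinₛ Q _ (A i k) w)) ⟩
      sumFin Q (λ k → (A i k *ₛ sumFinₛ Q (λ l → B k l *ₛ C l j)) w) ∎

    *M-identityˡ : ∀ (A : Mat n Q) → (idM *M A) ≈M A
    *M-identityˡ A i j w = begin
      sumFin Q (λ k → (idM i k *ₛ A k j) w)
        ≈⟨ sumFin-single Q i _ (λ k i≢k → trans (*ₛ-cong (λ u → reflexive (P.cong-app (idM-offdiag i k i≢k) u)) (λ _ → refl) w)
                                                 (0ₛ-*ₛ (A k j) w)) ⟩
      (idM i i *ₛ A i j) w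
        ≈⟨ *ₛ-cong (λ u → reflexive (P.cong-app (idM-diag i) u)) (λ _ → refl) w ⟩
      (1ₛ *ₛ A i j) w
        ≈⟨ constₛ-*ₛ 1# (A i j) w ⟩
      1# * A i j w
        ≈⟨ *-identityˡ _ ⟩
      A i j w ∎

    *M-identityʳ : ∀ (A : Mat n Q) → (A *M idM) ≈M A
    *M-identityʳ A i j w = begin
      sumFin Q (λ k → (A i k *ₛ idM k j) w)
        ≈⟨ sumFin-single Q j _ (λ k j≢k → trans (*ₛ-cong (λ _ → refl) (λ u → reflexive (P.cong-app (idM-offdiag k j (j≢k ∘ P.sym)) u)) w)
                                                 (*ₛ-0ₛ (A i k) w)) ⟩
      (A i j *ₛ idM j j) w
        ≈⟨ *ₛ-cong (λ _ → refl) (λ u → reflexive (P.cong-app (idM-diag j) u)) w ⟩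
      (A i j *ₛ 1ₛ) w
        ≈⟨ *ₛ-constₛ 1# (A i j) w ⟩
      1# * A i j w
        ≈⟨ *-identityˡ _ ⟩
      A i j w ∎

    prodM-++ : ∀ {m} (M : Fin m → Mat n Q) (u v : Word m) → prodM M (u ++ v) ≈M (prodM M u *M prodM M v)
    prodM-++ M [] v = ≈M-sym (*M-identityˡ (prodM M v))
    prodM-++ M (x ∷ u) v = ≈M-trans (*M-cong {A = M x} (λ _ _ _ → refl) (prodM-++ M u v)) (≈M-sym (*M-assoc (M x) (prodM M u) (prodM M v)))

  module Substitution {m N Q : ℕ} (M : Fin m → Mat N Q) where
    open SeriesLaws {N}
    open MatrixLaws {N} {Q}

    monomial : Word m → Mat N Q
    monomial = prodM M

    substTrunc : ℕ → Series m → Mat N Q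
    substTrunc D s i j x = sumUpTo D (λ d → sumLen d (λ w → s w * monomial w i j x))

    substTrunc-cong : ∀ D {s t : Series m} → s ≈ₛ t → substTrunc D s ≈M substTrunc D t
    substTrunc-cong D e i j x = lin-cong (sumUpTo-linear D) (λ d → lin-cong (sumLen-linear d) (λ w → *-congʳ (e w)))

    substTrunc-+ₛ : ∀ D (s t : Series m) i j x → substTrunc D (s +ₛ t) i j x ≈ substTrunc D s i j x + substTrunc D t i j x
    substTrunc-+ₛ D s t i j x = trans (lin-cong (sumUpTo-linear D) (λ d → trans (lin-cong (sumLen-linear d) (λ w → distribʳ _ _ _)) (lin-+ (sumLen-linear d) _ _)))
                                (lin-+ (sumUpTo-linear D) _ _)

    substTrunc-sumFinₛ : ∀ D k (h : Fin k → Series m) i j x → substTrunc D (sumFinₛ k h) i j x ≈ sumFin k (λ l → substTrunc D (h l) i j x)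
    substTrunc-sumFinₛ D k h i j x = trans (lin-cong (sumUpTo-linear D) (λ d → trans (lin-cong (sumLen-linear d) (λ w → lin-*ʳ (sumFin-linear k) _ _))
                                     (sym (sumFin-swap (sumLen-linear d) k _))))
                                (sym (sumFin-swap (sumUpTo-linear D) k _))

    substTrunc-•ₛ : ∀ D k (s : Series m) i j x → substTrunc D (k •ₛ s) i j x ≈ k * substTrunc D s i j x
    substTrunc-•ₛ D k s i j x = sym (trans (lin-* (sumUpTo-linear D) k _) (lin-cong (sumUpTo-linear D) (λ d → trans (lin-* (sumLen-linear d) k _)
                                 (lin-cong (sumLen-linear d) (λ w → sym (*-assoc _ _ _))))))

    substTrunc-stable : ∀ D D' (s : Series m) → Deg≤ D s → D ≤ D' → substTrunc D' s ≈M substTrunc D s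
    substTrunc-stable D D' s v le i j x = sumUpTo-extend D D' _ le
      (λ d lt → sumLen-0 d _ (λ w eq → trans (*-congʳ (v w (P.subst (D <_) (P.sym eq) lt))) (zeroˡ _)))

    module _ (D1 D2 : ℕ) where
      doubleSum : (Word m → Word m → Carrier) → Carrier
      doubleSum F = sumUpTo D1 (λ j' → sumLen j' (λ u → sumUpTo D2 (λ l → sumLen l (λ v → F u v))))

      doubleSum-linear : IsLinear {A = Word m × Word m} (λ f → doubleSum (λ u v → f (u , v)))
      doubleSum-linear = IsLinear-∘ (IsLinear-Σ (IsLinear-Σ (sumUpTo-linear D1) (λ j' → sumLen-linear j')) (λ _ → IsLinear-Σ (sumUpTo-linear D2) (λ l → sumLen-linear l)))
                       (λ q → (proj₂ (proj₁ q) , proj₂ (proj₂ q)))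

      doubleSum-cong : ∀ {F G} → (∀ u v → F u v ≈ G u v) → doubleSum F ≈ doubleSum G
      doubleSum-cong e = lin-cong doubleSum-linear (λ p → e (proj₁ p) (proj₂ p))

      sumUpTo-*-sumUpTo : ∀ (α β : Word m → Carrier) → sumUpTo D1 (λ j' → sumLen j' α) * sumUpTo D2 (λ l → sumLen l β) ≈ doubleSum (λ u v → α u * β v)
      sumUpTo-*-sumUpTo α β = trans (lin-*ʳ (sumUpTo-linear D1) _ _) (lin-cong (sumUpTo-linear D1) (λ j' → trans (lin-*ʳ (sumLen-linear j') _ _)
        (lin-cong (sumLen-linear j') (λ u → trans (lin-* (sumUpTo-linear D2) _ _) (lin-cong (sumUpTo-linear D2) (λ l → lin-* (sumLen-linear l) _ _))))))

      -- Splitting every word as w = u v turns the sum over |w| ≤ D1 + D2 into one over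
      -- the triangle |u| + |v| ≤ D1 + D2, which the degree bounds cut down to the box.
      substTrunc-*ₛ-expand : ∀ (s t : Series m) → Deg≤ D1 s → Deg≤ D2 t → ∀ i j x →
        substTrunc (D1 +ℕ D2) (s *ₛ t) i j x ≈ doubleSum (λ u v → (s u * t v) * monomial (u ++ v) i j x)
      substTrunc-*ₛ-expand s t vs vt i j x = begin
        sumUpTo D (λ d → sumLen d (λ w → (s *ₛ t) w * monomial w i j x))
          ≈⟨ lin-cong (sumUpTo-linear D) (λ d → lin-cong (sumLen-linear d) (λ w → lin-*ʳ (sumOver-linear (splits w)) _ _)) ⟩
        sumUpTo D (λ d → sumLen d (λ w → sumOver (splits w) (λ p → (s (proj₁ p) * t (proj₂ p)) * monomial w i j x)))
          ≈⟨ lin-cong (sumUpTo-linear D) (λ d → lin-cong (sumLen-linear d) (λ w → reflexive (P.sym (sumOver-splits-++ w (λ u v w' → (s u * t v) * monomial w' i j x))))) ⟩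
        sumUpTo D (λ d → sumLen d (λ w → sumOver (splits w) (λ p → h (proj₁ p) (proj₂ p))))
          ≈⟨ lin-cong (sumUpTo-linear D) (λ d → sumLen-splits d _) ⟩
        sumUpTo D (λ d → sumUpTo d (λ j' → sumLen j' (λ u → sumLen (d ∸ℕ j') (λ v → h u v))))
          ≈⟨ sumUpTo-triangle D X ⟩
        sumUpTo D (λ j' → sumUpTo (D ∸ℕ j') (X j'))
          ≈⟨ sumUpTo-triangle≈box D1 D2 X X-vanishes₁ X-vanishes₂ ⟩
        sumUpTo D1 (λ j' → sumUpTo D2 (X j'))
          ≈⟨ lin-cong (sumUpTo-linear D1) (λ j' → sym (sumLen-swap (sumUpTo-linear D2) j' _)) ⟩
        doubleSum h ∎
        where
        D = D1 +ℕ D2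
        h : Word m → Word m → Carrier
        h u v = (s u * t v) * monomial (u ++ v) i j x
        X : ℕ → ℕ → Carrier
        X j' l = sumLen j' (λ u → sumLen l (λ v → h u v))
        X-vanishes₁ : ∀ j' l → D1 < j' → X j' l ≈ 0#
        X-vanishes₁ j' l lt = sumLen-0 j' _ (λ u eq → lin-0 (sumLen-linear l) _ (λ v →
          trans (*-congʳ (trans (*-congʳ (vs u (P.subst (D1 <_) (P.sym eq) lt))) (zeroˡ _))) (zeroˡ _)))
        X-vanishes₂ : ∀ j' l → D2 < l → X j' l ≈ 0#
        X-vanishes₂ j' l lt = lin-0 (sumLen-linear j') _ (λ u → sumLen-0 l _ (λ v eq →
          trans (*-congʳ (trans (*-congˡ (vt v (P.subst (D2 <_) (P.sym eq) lt))) (zeroʳ _))) (zeroˡ _)))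

      doubleSum-*M : ∀ (s t : Series m) i j x →
        doubleSum (λ u v → (s u * t v) * (monomial u *M monomial v) i j x) ≈ (substTrunc D1 s *M substTrunc D2 t) i j x
      doubleSum-*M s t i j x = begin
        doubleSum (λ u v → (s u * t v) * (monomial u *M monomial v) i j x)
          ≈⟨ doubleSum-cong (λ u v → sym (entry-product u v)) ⟩
        doubleSum (λ u v → sumFin Q (λ k → sumOver (splits x) (λ p → term k p u v)))
          ≈⟨ sym (sumFin-swap doubleSum-linear Q _) ⟩
        sumFin Q (λ k → doubleSum (λ u v → sumOver (splits x) (λ p → term k p u v)))
          ≈⟨ lin-cong (sumFin-linear Q) (λ k → sym (sumOver-swap doubleSum-linear (splits x) _)) ⟩
        sumFin Q (λ k → sumOver (splits x) (λ p → doubleSum (term k p)))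
          ≈⟨ lin-cong (sumFin-linear Q) (λ k → lin-cong (sumOver-linear (splits x)) (λ p → sym (sumUpTo-*-sumUpTo _ _))) ⟩
        (substTrunc D1 s *M substTrunc D2 t) i j x ∎
        where
        term : Fin Q → Word N × Word N → Word m → Word m → Carrier
        term k p u v = (s u * monomial u i k (proj₁ p)) * (t v * monomial v k j (proj₂ p))
        entry-product : ∀ u v → sumFin Q (λ k → sumOver (splits x) (λ p → term k p u v))
                                ≈ (s u * t v) * (monomial u *M monomial v) i j x
        entry-product u v =
          trans (lin-cong (sumFin-linear Q) (λ k → trans (lin-cong (sumOver-linear (splits x)) (λ p → *-interchange _ _ _ _))
                                                       (sym (lin-* (sumOver-linear (splits x)) _ _))))
                (sym (lin-* (sumFin-linear Q) _ _))

      substTrunc-*ₛ : ∀ (s t : Series m) → Deg≤ D1 s → Deg≤ D2 t →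
                      substTrunc (D1 +ℕ D2) (s *ₛ t) ≈M (substTrunc D1 s *M substTrunc D2 t)
      substTrunc-*ₛ s t vs vt i j x = begin
        substTrunc (D1 +ℕ D2) (s *ₛ t) i j x
          ≈⟨ substTrunc-*ₛ-expand s t vs vt i j x ⟩
        doubleSum (λ u v → (s u * t v) * monomial (u ++ v) i j x)
          ≈⟨ doubleSum-cong (λ u v → *-congˡ (prodM-++ M u v i j x)) ⟩
        doubleSum (λ u v → (s u * t v) * (monomial u *M monomial v) i j x)
          ≈⟨ doubleSum-*M s t i j x ⟩
        (substTrunc D1 s *M substTrunc D2 t) i j x ∎

    varₛ-self : ∀ (y : Fin m) → varₛ {m} y (y ∷ []) P.≡ 1#
    varₛ-self y with y ≟ᶠ y
    ... | yes _ = P.refl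
    ... | no ne = ⊥-elim (ne P.refl)

    varₛ-other : ∀ (y y' : Fin m) → ¬ (y P.≡ y') → varₛ {m} y (y' ∷ []) P.≡ 0#
    varₛ-other y y' ne with y ≟ᶠ y'
    ... | yes eq = ⊥-elim (ne eq)
    ... | no _ = P.refl

    substTrunc-varₛ : ∀ (y : Fin m) → substTrunc 1 (varₛ y) ≈M M y
    substTrunc-varₛ y i j x = begin
      0# * monomial [] i j x + sumFin m (λ y' → varₛ y (y' ∷ []) * monomial (y' ∷ []) i j x)
        ≈⟨ +-cong (zeroˡ _) (sumFin-single m y _ (λ y' ne → trans (*-congʳ (reflexive (varₛ-other y y' ne))) (zeroˡ _))) ⟩
      0# + varₛ y (y ∷ []) * monomial (y ∷ []) i j x
        ≈⟨ +-identityˡ _ ⟩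
      varₛ y (y ∷ []) * monomial (y ∷ []) i j x
        ≈⟨ *-congʳ (reflexive (varₛ-self y)) ⟩
      1# * monomial (y ∷ []) i j x
        ≈⟨ *-identityˡ _ ⟩
      (M y *M idM) i j x
        ≈⟨ *M-identityʳ (M y) i j x ⟩
      M y i j x ∎

    substM-unfold : ∀ (g : NCPoly m) (ws : List (Word m)) i j x →
      foldr (λ w acc → (coeff g w •M monomial w) +M acc) 0M ws i j x P.≡ sumOver ws (λ w → coeff g w * monomial w i j x)
    substM-unfold g [] i j x = P.refl
    substM-unfold g (w ∷ ws) i j x = P.cong (coeff g w * monomial w i j x +_) (substM-unfold g ws i j x)

    substM≈substTrunc : ∀ (g : NCPoly m) i j x → substM g M i j x ≈ substTrunc (bound g) (coeff g) i j x
    substM≈substTrunc g i j x =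
      trans (reflexive (substM-unfold g (wordsUpTo m (bound g)) i j x)) (sumOver-wordsUpTo m (bound g) _)

    substTrunc≈substM : ∀ D (s : Series m) (g : NCPoly m) → Deg≤ D s → s ≈ₛ coeff g → ∀ i j x →
      substTrunc D s i j x ≈ substM g M i j x
    substTrunc≈substM D s g vs e i j x = begin
      substTrunc D s i j x ≈⟨ sym (substTrunc-stable D (D ⊔ℕ bound g) s vs (NP.m≤m⊔n D (bound g)) i j x) ⟩
      substTrunc (D ⊔ℕ bound g) s i j x ≈⟨ substTrunc-cong (D ⊔ℕ bound g) e i j x ⟩
      substTrunc (D ⊔ℕ bound g) (coeff g) i j x ≈⟨ substTrunc-stable (bound g) (D ⊔ℕ bound g) (coeff g) (vanish g) (NP.m≤n⊔m D (bound g)) i j x ⟩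
      substTrunc (bound g) (coeff g) i j x ≈⟨ sym (substM≈substTrunc g i j x) ⟩
      substM g M i j x ∎

  depth : ∀ {m w} → ABP m w → ℕ
  depth source = 0
  depth (layer A E) = depth A +ℕ 1

  Deg≤-evalA : ∀ {m w} (A : ABP m w) v → Deg≤ (depth A) (evalA A v)
  Deg≤-evalA source v = Deg≤-constₛ 1#
  Deg≤-evalA (layer {w = w} A E) v' = Deg≤-sumFinₛ w (λ v → Deg≤-*ₛ (depth A) 1 (Deg≤-evalA A v) (Deg≤-linₛ (E v v')))

  module ABPTranslation {m N q : ℕ} (φ : Fin m → Fin (suc q) → Fin (suc q) → Entry N) where
    Q : ℕ
    Q = suc q
    M : Fin m → Mat N Q
    M y i j = entryₛ (φ y i j)
    open Substitution M public
    open SeriesLaws {N}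
    open MatrixLaws {N} {Q}

    -- Entry (k, k') of b₀ I + Σ_y b_y M_y as an affine linear form in the variables.
    translateLinForm : LinForm m → Fin Q → Fin Q → LinForm N
    translateLinForm (b₀ , b) k k' =
      b₀ * δ k k' + sumFin m (λ y → b y * constPart (φ y k k')) ,
      λ l → sumFin m (λ y → b y * varCoeff (φ y k k') l)

    linₛ-translateLinForm : ∀ (L : LinForm m) k k' x → linₛ (translateLinForm L k k') x ≈ substTrunc 1 (linₛ L) k k' x
    linₛ-translateLinForm (b₀ , b) k k' x = trans translated (sym substituted)
      where
      c₀ : Fin m → Carrier
      c₀ y = constPart (φ y k k')
      cᵥ : Fin m → Fin N → Carrier
      cᵥ y l = varCoeff (φ y k k') l
      expanded : Carrier
      expanded = b₀ * (δ k k' * 1ₛ x) + sumFin m (λ y → b y * (c₀ y * 1ₛ x + sumFin N (λ l → cᵥ y l * varₛ l x)))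
      translated : linₛ (translateLinForm (b₀ , b) k k') x ≈ expanded
      translated = begin
        constₛ (b₀ * δ k k' + sumFin m (λ y → b y * c₀ y)) x + sumFin N (λ l → sumFin m (λ y → b y * cᵥ y l) * varₛ l x)
          ≈⟨ +-cong (constₛ≈*1ₛ _ x) (lin-cong (sumFin-linear N) (λ l → lin-*ʳ (sumFin-linear m) _ _)) ⟩
        (b₀ * δ k k' + sumFin m (λ y → b y * c₀ y)) * 1ₛ x + sumFin N (λ l → sumFin m (λ y → (b y * cᵥ y l) * varₛ l x))
          ≈⟨ +-cong (trans (distribʳ _ _ _) (+-cong (*-assoc _ _ _) (lin-*ʳ (sumFin-linear m) _ _)))
                    (sumFin-swap (sumFin-linear m) N _) ⟩
        (b₀ * (δ k k' * 1ₛ x) + sumFin m (λ y → (b y * c₀ y) * 1ₛ x)) +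
          sumFin m (λ y → sumFin N (λ l → (b y * cᵥ y l) * varₛ l x))
          ≈⟨ +-assoc _ _ _ ⟩
        b₀ * (δ k k' * 1ₛ x) +
          (sumFin m (λ y → (b y * c₀ y) * 1ₛ x) + sumFin m (λ y → sumFin N (λ l → (b y * cᵥ y l) * varₛ l x)))
          ≈⟨ +-congˡ (sym (lin-+ (sumFin-linear m) _ _)) ⟩
        b₀ * (δ k k' * 1ₛ x) + sumFin m (λ y → (b y * c₀ y) * 1ₛ x + sumFin N (λ l → (b y * cᵥ y l) * varₛ l x))
          ≈⟨ +-congˡ (lin-cong (sumFin-linear m) (λ y → +-cong (*-assoc _ _ _)
               (trans (lin-cong (sumFin-linear N) (λ l → *-assoc _ _ _)) (sym (lin-* (sumFin-linear N) _ _))))) ⟩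
        b₀ * (δ k k' * 1ₛ x) + sumFin m (λ y → b y * (c₀ y * 1ₛ x) + b y * sumFin N (λ l → cᵥ y l * varₛ l x))
          ≈⟨ +-congˡ (lin-cong (sumFin-linear m) (λ y → sym (distribˡ _ _ _))) ⟩
        expanded ∎
      substituted : substTrunc 1 (linₛ (b₀ , b)) k k' x ≈ expanded
      substituted = begin
        substTrunc 1 (constₛ b₀ +ₛ sumFinₛ m (λ y → b y •ₛ varₛ y)) k k' x
          ≈⟨ substTrunc-+ₛ 1 (constₛ b₀) (sumFinₛ m (λ y → b y •ₛ varₛ y)) k k' x ⟩
        substTrunc 1 (constₛ b₀) k k' x + substTrunc 1 (sumFinₛ m (λ y → b y •ₛ varₛ y)) k k' x
          ≈⟨ +-cong (substTrunc-stable 0 1 (constₛ b₀) (Deg≤-constₛ b₀) z≤n k k' x)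
                    (substTrunc-sumFinₛ 1 m (λ y → b y •ₛ varₛ y) k k' x) ⟩
        b₀ * idM k k' x + sumFin m (λ y → substTrunc 1 (b y •ₛ varₛ y) k k' x)
          ≈⟨ +-cong (*-congˡ (idM≈δ*1ₛ k k' x))
                    (lin-cong (sumFin-linear m) (λ y → trans (substTrunc-•ₛ 1 (b y) (varₛ y) k k' x)
                      (*-congˡ (trans (substTrunc-varₛ y k k' x) (entryₛ-decompose (φ y k k') x))))) ⟩
        expanded ∎

    constForm : Carrier → LinForm N
    constForm a = a , λ _ → 0#

    linₛ-constForm : ∀ a (x : Word N) → linₛ (constForm a) x ≈ constₛ a x
    linₛ-constForm a x = trans (+-congˡ (lin-0 (sumFin-linear N) _ (λ l → zeroˡ _))) (+-identityʳ _)

    column : Fin (1 *ℕ Q) → Fin Q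
    column y = proj₂ (remQuot {1} Q y)

    column-combine : ∀ k → column (combine {1} zero k) P.≡ k
    column-combine k = P.cong proj₂ (remQuot-combine {1} zero k)

    translateLayer : ∀ {w w'} → (Fin w → Fin w' → LinForm m) → Fin (w *ℕ Q) → Fin (w' *ℕ Q) → LinForm N
    translateLayer {w} {w'} E x y = translateLinForm (E (proj₁ (remQuot {w} Q x)) (proj₁ (remQuot {w'} Q y)))
                                                     (proj₂ (remQuot {w} Q x)) (proj₂ (remQuot {w'} Q y))

    translateLayer-combine : ∀ {w w'} (E : Fin w → Fin w' → LinForm m) v k v' k' →
      translateLayer E (combine v k) (combine v' k') P.≡ translateLinForm (E v v') k k'
    translateLayer-combine E v k v' k' =
      P.cong₂ (λ p p' → translateLinForm (E (proj₁ p) (proj₁ p')) (proj₂ p) (proj₂ p')) (remQuot-combine v k) (remQuot-combine v' k')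

    -- The first layer carries row 0 of the identity matrix.
    translateABP : ∀ {w} → ABP m w → ABP N (w *ℕ Q)
    translateABP source      = layer source (λ _ y → constForm (δ zero (column y)))
    translateABP (layer A E) = layer (translateABP A) (translateLayer E)

    evalA-translateABP : ∀ {w} (A : ABP m w) v k x →
      evalA (translateABP A) (combine v k) x ≈ substTrunc (depth A) (evalA A v) zero k x
    evalA-translateABP source zero k x = begin
      (1ₛ *ₛ linₛ (constForm (δ zero (column (combine {1} zero k))))) x + 0#
        ≈⟨ +-identityʳ _ ⟩
      (1ₛ *ₛ linₛ (constForm (δ zero (column (combine {1} zero k))))) x
        ≈⟨ trans (constₛ-*ₛ 1# _ x) (*-identityˡ _) ⟩
      linₛ (constForm (δ zero (column (combine {1} zero k)))) x
        ≡⟨ P.cong (λ c → linₛ (constForm (δ zero c)) x) (column-combine k) ⟩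
      linₛ (constForm (δ zero k)) x
        ≈⟨ trans (linₛ-constForm _ x) (trans (constₛ≈*1ₛ _ x) (sym (idM≈δ*1ₛ zero k x))) ⟩
      idM zero k x
        ≈⟨ *-identityˡ _ ⟨
      1# * idM zero k x ∎
    evalA-translateABP (layer {w = w} A E) v' k' x = begin
      sumFin (w *ℕ Q) (λ z → (evalA (translateABP A) z *ₛ linₛ (translateLayer E z (combine v' k'))) x)
        ≈⟨ sumFin-combine w Q _ ⟩
      sumFin w (λ v → sumFin Q (λ k →
        (evalA (translateABP A) (combine v k) *ₛ linₛ (translateLayer E (combine v k) (combine v' k'))) x))
        ≈⟨ lin-cong (sumFin-linear w) (λ v → lin-cong (sumFin-linear Q) (λ k →
             *ₛ-cong (evalA-translateABP A v k) (edge v k) x)) ⟩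
      sumFin w (λ v → (substTrunc (depth A) (evalA A v) *M substTrunc 1 (linₛ (E v v'))) zero k' x)
        ≈⟨ lin-cong (sumFin-linear w) (λ v →
             substTrunc-*ₛ (depth A) 1 (evalA A v) (linₛ (E v v')) (Deg≤-evalA A v) (Deg≤-linₛ (E v v')) zero k' x) ⟨
      sumFin w (λ v → substTrunc (depth A +ℕ 1) (evalA A v *ₛ linₛ (E v v')) zero k' x)
        ≈⟨ substTrunc-sumFinₛ (depth A +ℕ 1) w _ zero k' x ⟨
      substTrunc (depth A +ℕ 1) (evalA (layer A E) v') zero k' x ∎
      where
      edge : ∀ v k → linₛ (translateLayer E (combine v k) (combine v' k')) ≈ₛ substTrunc 1 (linₛ (E v v')) k k'
      edge v k x' = trans (reflexive (P.cong (λ L → linₛ L x') (translateLayer-combine E v k v' k')))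
                          (linₛ-translateLinForm (E v v') k k' x')

    projectABP : ABP m 1 → ABP N 1
    projectABP A = layer (translateABP A) (λ y _ → constForm (δ (column y) (fromℕ q)))

    evalA-projectABP : ∀ (A : ABP m 1) x →
      evalA (projectABP A) zero x ≈ substTrunc (depth A) (evalA A zero) zero (fromℕ q) x
    evalA-projectABP A x = begin
      sumFin (1 *ℕ Q) (λ z → (evalA (translateABP A) z *ₛ linₛ (constForm (δ (column z) (fromℕ q)))) x)
        ≈⟨ sumFin-combine 1 Q (λ z → (evalA (translateABP A) z *ₛ linₛ (constForm (δ (column z) (fromℕ q)))) x) ⟩
      sumFin Q (λ k → (evalA (translateABP A) (combine {1} zero k) *ₛ linₛ (selector k)) x) + 0#
        ≈⟨ +-identityʳ _ ⟩
      sumFin Q (λ k → (evalA (translateABP A) (combine {1} zero k) *ₛ linₛ (selector k)) x)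
        ≈⟨ lin-cong (sumFin-linear Q) (λ k →
             trans (*ₛ-cong (evalA-translateABP A zero k) (linₛ-selector k) x) (*ₛ-constₛ _ _ x)) ⟩
      sumFin Q (λ k → δ k (fromℕ q) * entry k)
        ≈⟨ sumFin-single Q (fromℕ q) (λ k → δ k (fromℕ q) * entry k)
             (λ k q≢k → trans (*-congʳ (reflexive (δ-offdiag k (fromℕ q) (q≢k ∘ P.sym)))) (zeroˡ _)) ⟩
      δ (fromℕ q) (fromℕ q) * entry (fromℕ q)
        ≈⟨ trans (*-congʳ (reflexive (δ-diag (fromℕ q)))) (*-identityˡ _) ⟩
      entry (fromℕ q) ∎
      where
      entry : Fin Q → Carrier
      entry k = substTrunc (depth A) (evalA A zero) zero k x
      selector : Fin Q → LinForm N
      selector k = constForm (δ (column (combine {1} zero k)) (fromℕ q))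
      linₛ-selector : ∀ k → linₛ (selector k) ≈ₛ constₛ (δ k (fromℕ q))
      linₛ-selector k x' = trans (reflexive (P.cong (λ c → linₛ (constForm (δ c (fromℕ q))) x') (column-combine k)))
                                 (linₛ-constForm _ x')

    sizeA-translateABP : ∀ {w} (A : ABP m w) → sizeA (translateABP A) P.≡ sizeA A *ℕ Q +ℕ 1
    sizeA-translateABP source = NP.+-comm 1 (Q +ℕ 0)
    sizeA-translateABP (layer {w' = w'} A E) rewrite sizeA-translateABP A = regroup (sizeA A) w' Q
      where
      open import Data.Nat.Tactic.RingSolver
      regroup : ∀ s w Q → s *ℕ Q +ℕ 1 +ℕ w *ℕ Q P.≡ (s +ℕ w) *ℕ Q +ℕ 1
      regroup = solve-∀

    sizeA-projectABP : ∀ (A : ABP m 1) → sizeA (projectABP A) ≤ sizeA A *ℕ (Q ^ 3 *ℕ 2) +ℕ 2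
    sizeA-projectABP A rewrite sizeA-translateABP A = NP.≤-trans (NP.≤-reflexive (NP.+-assoc (sizeA A *ℕ Q) 1 1))
      (NP.+-monoˡ-≤ 2 (NP.*-monoʳ-≤ (sizeA A) (NP.≤-trans (NP.m≤m*n Q (Q *ℕ (Q *ℕ 1))) (NP.m≤m*n (Q ^ 3) 2))))

module Circuits {c ℓ} (F : Field c ℓ) where

  open import Level using (_⊔_)
  open import Data.Nat using (ℕ; zero; suc; _≤_; _<_; z≤n; s≤s; _^_) renaming (_+_ to _+ℕ_; _*_ to _*ℕ_)
  import Data.Nat.Properties as NP
  open import Data.Fin using (Fin; zero; suc; fromℕ)
  open import Data.Vec using (Vec; []; _∷ʳ_; lookup)
  import Data.Vec.Properties as VP
  open import Data.Vec.Functional using () renaming (_∷_ to _∷ᶠ_)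
  open import Data.Bool using (false; T)
  open import Data.Product using (_×_; _,_; proj₁; proj₂)
  open import Data.Sum using (_⊎_; inj₁; inj₂) renaming (map to ⊎-map)
  open import Data.Empty using (⊥-elim)
  open import Data.Unit.Polymorphic using (tt)
  import Relation.Binary.PropositionalEquality as P
  open VecIndexing
  open Field F hiding (zero)
  open NC F
  open SeriesAlgebra F
  open import Relation.Binary.Reasoning.Setoid setoid

  data RawGate (N : ℕ) : Set c where
    rVar : Fin N → RawGate N
    rConst : Carrier → RawGate N
    rAdd rMul : ℕ → ℕ → RawGate N

  data Program (N : ℕ) : Set c where
    ε : Program N
    _▸_ : Program N → RawGate N → Program N

  module Programs {N : ℕ} where
    open SeriesLaws {N}
    len : Program N → ℕ
    len ε = 0
    len (P ▸ g) = suc (len P)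

    -- Gates refer to earlier gates by position; out-of-range positions are clamped,
    -- which never happens for the programs built below.
    toGate : ∀ k → RawGate N → Gate N k
    toGate k (rVar i) = inVar i
    toGate k (rConst a) = inConst a
    toGate zero (rAdd _ _) = inConst 0#
    toGate (suc k) (rAdd i j) = add (clampFin k i) (clampFin k j)
    toGate zero (rMul _ _) = inConst 0#
    toGate (suc k) (rMul i j) = mul (clampFin k i) (clampFin k j)

    toCircuit : (P : Program N) → Circuit N (len P)
    toCircuit ε = []
    toCircuit (P ▸ g) = toCircuit P ▷ toGate (len P) g

    values : (P : Program N) → Vec (Series N) (len P)
    values P = evalC (toCircuit P)

    valueAt : Program N → ℕ → Series N
    valueAt P i = lookupℕ (values P) i 0ₛ

    IsInputAt : Program N → ℕ → Set
    IsInputAt P i = T (lookupℕ (inputFlags (toCircuit P)) i false)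

    SkewProgram : Program N → Set
    SkewProgram P = Skew (toCircuit P)

    data _⊑_ : Program N → Program N → Set c where
      ⊑-refl : ∀ {P} → P ⊑ P
      ⊑-step : ∀ {P P' g} → P ⊑ P' → P ⊑ (P' ▸ g)

    ⊑-trans : ∀ {P1 P2 P3} → P1 ⊑ P2 → P2 ⊑ P3 → P1 ⊑ P3
    ⊑-trans e ⊑-refl = e
    ⊑-trans e (⊑-step e') = ⊑-step (⊑-trans e e')

    ⊑-len : ∀ {P P'} → P ⊑ P' → len P ≤ len P'
    ⊑-len ⊑-refl = NP.≤-refl
    ⊑-len (⊑-step e) = NP.m≤n⇒m≤1+n (⊑-len e)

    ⊑-valueAt : ∀ {P P'} → P ⊑ P' → ∀ i → i < len P → valueAt P' i P.≡ valueAt P i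
    ⊑-valueAt ⊑-refl i lt = P.refl
    ⊑-valueAt (⊑-step {P' = P'} {g} e) i lt =
      P.trans (lookupℕ-∷ʳ-< (values P') (evalGate (values P') (toGate (len P') g)) i 0ₛ (NP.<-≤-trans lt (⊑-len e))) (⊑-valueAt e i lt)

    ⊑-IsInputAt : ∀ {P P'} → P ⊑ P' → ∀ i → i < len P → IsInputAt P i → IsInputAt P' i
    ⊑-IsInputAt ⊑-refl i lt x = x
    ⊑-IsInputAt (⊑-step {P' = P'} {g} e) i lt x =
      P.subst T (P.sym (lookupℕ-∷ʳ-< (inputFlags (toCircuit P')) _ i false (NP.<-≤-trans lt (⊑-len e)))) (⊑-IsInputAt e i lt x)

    GateComputes : Program N → ℕ → Series N → Set ℓ
    GateComputes P r s = (r < len P) × (valueAt P r ≈ₛ s)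

    GateComputes-⊑ : ∀ {P P' r s} → P ⊑ P' → GateComputes P r s → GateComputes P' r s
    GateComputes-⊑ e (lt , eq) = NP.<-≤-trans lt (⊑-len e) , λ w → trans (reflexive (P.cong (λ z → z w) (⊑-valueAt e _ lt))) (eq w)

    GateComputes-cong : ∀ {P r s s'} → s ≈ₛ s' → GateComputes P r s → GateComputes P r s'
    GateComputes-cong e (lt , eq) = lt , λ w → trans (eq w) (e w)

    InputGate : Program N → ℕ → Set
    InputGate P r = (r < len P) × IsInputAt P r

    InputGate-⊑ : ∀ {P P' r} → P ⊑ P' → InputGate P r → InputGate P' r
    InputGate-⊑ e (lt , x) = NP.<-≤-trans lt (⊑-len e) , ⊑-IsInputAt e _ lt x

    push : RawGate N → Program N → Program N × ℕ
    push g P = (P ▸ g) , len P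

    valueAt-push : ∀ P g → valueAt (P ▸ g) (len P) P.≡ evalGate (values P) (toGate (len P) g)
    valueAt-push P g = lookupℕ-∷ʳ-length (values P) _ 0ₛ

    evalGate-rAdd : ∀ P r1 r2 → r1 < len P → r2 < len P → evalGate (values P) (toGate (len P) (rAdd r1 r2)) P.≡ (valueAt P r1 +ₛ valueAt P r2)
    evalGate-rAdd P r1 r2 l1 l2 with len P | values P
    ... | zero | vs = ⊥-elim (NP.n≮0 l1)
    ... | suc k | vs = P.cong₂ _+ₛ_ (lookup-clampFin vs r1 0ₛ (NP.≤-pred l1)) (lookup-clampFin vs r2 0ₛ (NP.≤-pred l2))

    evalGate-rMul : ∀ P r1 r2 → r1 < len P → r2 < len P → evalGate (values P) (toGate (len P) (rMul r1 r2)) P.≡ (valueAt P r1 *ₛ valueAt P r2)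
    evalGate-rMul P r1 r2 l1 l2 with len P | values P
    ... | zero | vs = ⊥-elim (NP.n≮0 l1)
    ... | suc k | vs = P.cong₂ _*ₛ_ (lookup-clampFin vs r1 0ₛ (NP.≤-pred l1)) (lookup-clampFin vs r2 0ₛ (NP.≤-pred l2))

    Skew-rVar : ∀ P i → SkewProgram P → SkewProgram (P ▸ rVar i)
    Skew-rVar P i s = s , tt
    Skew-rConst : ∀ P a → SkewProgram P → SkewProgram (P ▸ rConst a)
    Skew-rConst P a s = s , tt
    Skew-rAdd : ∀ P r1 r2 → SkewProgram P → SkewProgram (P ▸ rAdd r1 r2)
    Skew-rAdd P r1 r2 s with len P | toCircuit P
    ... | zero | C = s , tt
    ... | suc k | C = s , tt

    Skew-rMul : ∀ P r1 r2 → SkewProgram P → r1 < len P → r2 < len P → (IsInputAt P r1 ⊎ IsInputAt P r2) → SkewProgram (P ▸ rMul r1 r2)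
    Skew-rMul P r1 r2 s l1 l2 side with len P | toCircuit P
    ... | zero | C = ⊥-elim (NP.n≮0 l1)
    ... | suc k | C = s , ⊎-map (P.subst T (P.sym (lookup-clampFin (inputFlags C) r1 false (NP.≤-pred l1))))
                                 (P.subst T (P.sym (lookup-clampFin (inputFlags C) r2 false (NP.≤-pred l2)))) side

    IsInputAt-rVar : ∀ P i → IsInputAt (P ▸ rVar i) (len P)
    IsInputAt-rVar P i = P.subst T (P.sym (lookupℕ-∷ʳ-length (inputFlags (toCircuit P)) _ false)) _
    IsInputAt-rConst : ∀ P a → IsInputAt (P ▸ rConst a) (len P)
    IsInputAt-rConst P a = P.subst T (P.sym (lookupℕ-∷ʳ-length (inputFlags (toCircuit P)) _ false)) _

    buildAll : ∀ {A : Set} k → (Fin k → Program N → Program N × A) → Program N → Program N × (Fin k → A)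
    buildAll zero    f P = P , λ ()
    buildAll (suc k) f P =
      proj₁ (buildAll k (λ i → f (suc i)) (proj₁ (f zero P))) ,
      proj₂ (f zero P) ∷ᶠ proj₂ (buildAll k (λ i → f (suc i)) (proj₁ (f zero P)))

    record Extension {a d} {A : Set} (Inv : Program N → Set a) (Goal : Program N → A → Set d)
                     (k : ℕ) (P : Program N) (result : Program N × A) : Set (c ⊔ a ⊔ d) where
      constructor extension
      field
        extends   : P ⊑ proj₁ result
        achieves  : Goal (proj₁ result) (proj₂ result)
        len-≤     : len (proj₁ result) ≤ len P +ℕ k
        preserves : Inv P → Inv (proj₁ result)
    open Extension public

    Builds : ∀ {a b d} {A : Set} → (Program N → Set a) → (Program N → Set b) → (Program N → A → Set d) → ℕ →
             (Program N → Program N × A) → Set (c ⊔ a ⊔ b ⊔ d)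
    Builds Pre Inv Goal k f = ∀ P → Pre P → Extension Inv Goal k P (f P)

    push-spec : ∀ {a b d} {Pre : Program N → Set a} {Inv : Program N → Set b} {Goal : Program N → ℕ → Set d} g →
      (∀ P → Pre P → Goal (P ▸ g) (len P)) → (∀ P → Inv P → Inv (P ▸ g)) → Builds Pre Inv Goal 1 (push g)
    push-spec g goal inv P pre = extension (⊑-step ⊑-refl) (goal P pre) (NP.≤-reflexive (NP.+-comm 1 (len P))) (inv P)

    buildAll-spec : ∀ {a b d} {A : Set} {Pre : Program N → Set a} {Inv : Program N → Set b} k
      (f : Fin k → Program N → Program N × A) (Goal : Fin k → Program N → A → Set d) →
      (∀ {P P'} → P ⊑ P' → Pre P → Pre P') → (∀ i {P P' x} → P ⊑ P' → Goal i P x → Goal i P' x) →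
      ∀ c' → (∀ i → Builds Pre Inv (Goal i) c' (f i)) →
      Builds Pre Inv (λ P xs → ∀ i → Goal i P (xs i)) (k *ℕ c') (buildAll k f)
    buildAll-spec zero f Goal pre-⊑ goal-⊑ c' step P pre =
      extension ⊑-refl (λ ()) (NP.≤-reflexive (P.sym (NP.+-identityʳ (len P)))) (λ inv → inv)
    buildAll-spec {Inv = Inv} (suc k) f Goal pre-⊑ goal-⊑ c' step P pre =
      extension (⊑-trans (extends first) (extends rest)) achieved len≤ (λ inv → preserves rest (preserves first inv))
      where
      first : Extension Inv (Goal zero) c' P (f zero P)
      first = step zero P pre
      rest : Extension Inv (λ P' xs → ∀ i → Goal (suc i) P' (xs i)) (k *ℕ c') (proj₁ (f zero P))
                       (buildAll k (λ i → f (suc i)) (proj₁ (f zero P)))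
      rest = buildAll-spec k (λ i → f (suc i)) (λ i → Goal (suc i)) pre-⊑ (λ i → goal-⊑ (suc i)) c'
               (λ i → step (suc i)) (proj₁ (f zero P)) (pre-⊑ (extends first) pre)
      achieved : ∀ i → Goal i (proj₁ (buildAll (suc k) f P)) (proj₂ (buildAll (suc k) f P) i)
      achieved zero    = goal-⊑ zero (extends rest) (achieves first)
      achieved (suc i) = achieves rest i
      len≤ : len (proj₁ (buildAll (suc k) f P)) ≤ len P +ℕ (c' +ℕ k *ℕ c')
      len≤ = NP.≤-trans (len-≤ rest) (NP.≤-trans (NP.+-monoˡ-≤ (k *ℕ c') (len-≤ first))
                                                 (NP.≤-reflexive (NP.+-assoc (len P) c' (k *ℕ c'))))

    dotProduct : ∀ n' → (Fin (suc n') → ℕ) → (Fin (suc n') → ℕ) → Program N → Program N × ℕ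
    dotProduct zero x y P = push (rMul (x zero) (y zero)) P
    dotProduct (suc n') x y P =
      push (rAdd (len P) (proj₂ (dotProduct n' (λ i → x (suc i)) (λ i → y (suc i)) (P ▸ rMul (x zero) (y zero)))))
           (proj₁ (dotProduct n' (λ i → x (suc i)) (λ i → y (suc i)) (P ▸ rMul (x zero) (y zero))))

    DotProductPre : (Sk : Set) → ∀ n' → (x y : Fin (suc n') → ℕ) (sx sy : Fin (suc n') → Series N) → Program N → Set ℓ
    DotProductPre Sk n' x y sx sy P =
      (∀ i → GateComputes P (x i) (sx i) × GateComputes P (y i) (sy i)) ×
      (Sk → (∀ i → IsInputAt P (x i)) ⊎ (∀ i → IsInputAt P (y i)))

    DotProductPre-⊑ : ∀ Sk n' x y sx sy {P P'} → P ⊑ P' → DotProductPre Sk n' x y sx sy P → DotProductPre Sk n' x y sx sy P'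
    DotProductPre-⊑ Sk n' x y sx sy e (gs , side) =
      (λ i → GateComputes-⊑ e (proj₁ (gs i)) , GateComputes-⊑ e (proj₂ (gs i))) ,
      λ sk → ⊎-map (λ h i → ⊑-IsInputAt e _ (proj₁ (proj₁ (gs i))) (h i))
                   (λ h i → ⊑-IsInputAt e _ (proj₁ (proj₂ (gs i))) (h i)) (side sk)

    dotProduct-spec : ∀ (Sk : Set) n' (x y : Fin (suc n') → ℕ) (sx sy : Fin (suc n') → Series N) →
      Builds (DotProductPre Sk n' x y sx sy) (λ P → Sk → SkewProgram P)
             (λ P r → GateComputes P r (sumFinₛ (suc n') (λ i → sx i *ₛ sy i))) (suc (n' +ℕ n')) (dotProduct n' x y)
    dotProduct-spec Sk zero x y sx sy P (gs , side) =
      extension (⊑-step ⊑-refl)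
        (NP.≤-refl , λ w → trans (reflexive (P.cong (λ z → z w) (P.trans (valueAt-push P (rMul (x zero) (y zero))) (evalGate-rMul P _ _ lx ly))))
                                 (trans (*ₛ-cong (proj₂ (proj₁ (gs zero))) (proj₂ (proj₂ (gs zero))) w) (sym (+-identityʳ _))))
        (NP.≤-reflexive (NP.+-comm 1 (len P)))
        (λ inv sk → Skew-rMul P _ _ (inv sk) lx ly (⊎-map (λ h → h zero) (λ h → h zero) (side sk)))
      where
      lx : x zero < len P
      lx = proj₁ (proj₁ (gs zero))
      ly : y zero < len P
      ly = proj₁ (proj₂ (gs zero))
    dotProduct-spec Sk (suc n') x y sx sy P pre@(gs , side) =
      extension (⊑-trans (⊑-step ⊑-refl) (⊑-step (extends rest))) computes len≤
        (λ inv sk → Skew-rAdd P₂ _ _ (preserves rest (λ sk' → Skew-rMul P _ _ (inv sk') lx ly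
                                                        (⊎-map (λ h → h zero) (λ h → h zero) (side sk'))) sk))
      where
      lx : x zero < len P
      lx = proj₁ (proj₁ (gs zero))
      ly : y zero < len P
      ly = proj₁ (proj₂ (gs zero))
      P₁ : Program N
      P₁ = P ▸ rMul (x zero) (y zero)
      pre₁ : DotProductPre Sk n' (λ i → x (suc i)) (λ i → y (suc i)) (λ i → sx (suc i)) (λ i → sy (suc i)) P₁
      pre₁ with DotProductPre-⊑ Sk (suc n') x y sx sy (⊑-step ⊑-refl) pre
      ... | gs₁ , side₁ = (λ i → gs₁ (suc i)) , λ sk → ⊎-map (λ h i → h (suc i)) (λ h i → h (suc i)) (side₁ sk)
      rest : Extension (λ P' → Sk → SkewProgram P') (λ P' r' → GateComputes P' r' (sumFinₛ (suc n') (λ i → sx (suc i) *ₛ sy (suc i))))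
                       (suc (n' +ℕ n')) P₁ (dotProduct n' (λ i → x (suc i)) (λ i → y (suc i)) P₁)
      rest = dotProduct-spec Sk n' (λ i → x (suc i)) (λ i → y (suc i)) (λ i → sx (suc i)) (λ i → sy (suc i)) P₁ pre₁
      P₂ : Program N
      P₂ = proj₁ (dotProduct n' (λ i → x (suc i)) (λ i → y (suc i)) P₁)
      r : ℕ
      r = proj₂ (dotProduct n' (λ i → x (suc i)) (λ i → y (suc i)) P₁)
      len-P<len-P₂ : len P < len P₂
      len-P<len-P₂ = NP.<-≤-trans NP.≤-refl (⊑-len (extends rest))
      computes : GateComputes (P₂ ▸ rAdd (len P) r) (len P₂) (sumFinₛ (suc (suc n')) (λ i → sx i *ₛ sy i))
      computes = NP.≤-refl , λ w → begin
        valueAt (P₂ ▸ rAdd (len P) r) (len P₂) w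
          ≡⟨ P.cong (λ z → z w) (P.trans (valueAt-push P₂ (rAdd (len P) r)) (evalGate-rAdd P₂ _ _ len-P<len-P₂ (proj₁ (achieves rest)))) ⟩
        valueAt P₂ (len P) w + valueAt P₂ r w
          ≡⟨ P.cong (λ z → z w + valueAt P₂ r w) (⊑-valueAt (extends rest) (len P) NP.≤-refl) ⟩
        valueAt P₁ (len P) w + valueAt P₂ r w
          ≡⟨ P.cong (λ z → z w + valueAt P₂ r w) (P.trans (valueAt-push P (rMul (x zero) (y zero))) (evalGate-rMul P _ _ lx ly)) ⟩
        (valueAt P (x zero) *ₛ valueAt P (y zero)) w + valueAt P₂ r w
          ≈⟨ +-cong (*ₛ-cong (proj₂ (proj₁ (gs zero))) (proj₂ (proj₂ (gs zero))) w) (proj₂ (achieves rest) w) ⟩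
        sumFinₛ (suc (suc n')) (λ i → sx i *ₛ sy i) w ∎
      len≤ : suc (len P₂) ≤ len P +ℕ suc (suc n' +ℕ suc n')
      len≤ = NP.≤-trans (s≤s (len-≤ rest)) (NP.≤-reflexive (regroup (len P) n'))
        where
        open import Data.Nat.Tactic.RingSolver
        regroup : ∀ L n' → suc (suc L +ℕ suc (n' +ℕ n')) P.≡ L +ℕ suc (suc n' +ℕ suc n')
        regroup = solve-∀

  outC≡lookup : ∀ {n k} (C : Circuit n (suc k)) → outC C P.≡ lookup (evalC C) (fromℕ k)
  outC≡lookup (C ▷ g) = P.trans (VP.last-∷ʳ _ (evalC C)) (P.sym (lookup-∷ʳ-fromℕ (evalC C) _))

  1≤2^k : ∀ k → 1 ≤ 2 ^ k
  1≤2^k k = NP.m^n>0 2 k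

  2^k≤2^[1+k] : ∀ k → 2 ^ k ≤ 2 ^ suc k
  2^k≤2^[1+k] k = NP.m≤m+n (2 ^ k) (2 ^ k +ℕ 0)

  2^k+2^k≤2^[1+k] : ∀ k → 2 ^ k +ℕ 2 ^ k ≤ 2 ^ suc k
  2^k+2^k≤2^[1+k] k = NP.≤-reflexive (P.cong (2 ^ k +ℕ_) (P.sym (NP.+-identityʳ (2 ^ k))))

  Deg≤-evalGate : ∀ {m k} (vs : Vec (Series m) k) (g : Gate m k) →
                  (∀ i → Deg≤ (2 ^ k) (lookup vs i)) → Deg≤ (2 ^ suc k) (evalGate vs g)
  Deg≤-evalGate {k = k} vs (inVar y)   deg = Deg≤-mono (Deg≤-varₛ y) (NP.≤-trans (1≤2^k k) (2^k≤2^[1+k] k))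
  Deg≤-evalGate         vs (inConst a) deg = Deg≤-mono (Deg≤-constₛ a) z≤n
  Deg≤-evalGate {k = k} vs (add i j)   deg = Deg≤-mono (Deg≤-+ₛ (deg i) (deg j)) (2^k≤2^[1+k] k)
  Deg≤-evalGate {k = k} vs (mul i j)   deg = Deg≤-mono (Deg≤-*ₛ (2 ^ k) (2 ^ k) (deg i) (deg j)) (2^k+2^k≤2^[1+k] k)

  module CircuitTranslation {m N q : ℕ} (φ : Fin m → Fin (suc q) → Fin (suc q) → Entry N) where
    open Programs {N}
    open ABPTranslation φ
    open SeriesLaws {N}
    open MatrixLaws {N} {Q}

    Table : Set
    Table = Fin Q → Fin Q → ℕ

    entryGate : Entry N → RawGate N
    entryGate (cst a) = rConst a
    entryGate (var l) = rVar l

    evalGate-entryGate : ∀ P e → evalGate (values P) (toGate (len P) (entryGate e)) P.≡ entryₛ e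
    evalGate-entryGate P (cst a) = P.refl
    evalGate-entryGate P (var l) = P.refl

    IsInputAt-entryGate : ∀ P e → IsInputAt (P ▸ entryGate e) (len P)
    IsInputAt-entryGate P (cst a) = IsInputAt-rConst P a
    IsInputAt-entryGate P (var l) = IsInputAt-rVar P l

    Skew-entryGate : ∀ P e → SkewProgram P → SkewProgram (P ▸ entryGate e)
    Skew-entryGate P (cst a) s = Skew-rConst P a s
    Skew-entryGate P (var l) s = Skew-rVar P l s

    buildTable : (Fin Q → Fin Q → Program N → Program N × ℕ) → Program N → Program N × Table
    buildTable h P = buildAll Q (λ a → buildAll Q (λ b → h a b)) P

    buildTable-spec : ∀ {a' b' d} {Pre : Program N → Set a'} {Inv : Program N → Set b'} (h : Fin Q → Fin Q → Program N → Program N × ℕ)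
      (Goal : Fin Q → Fin Q → Program N → ℕ → Set d) → (∀ {P P'} → P ⊑ P' → Pre P → Pre P') →
      (∀ a b {P P' x} → P ⊑ P' → Goal a b P x → Goal a b P' x) → ∀ c' → (∀ a b → Builds Pre Inv (Goal a b) c' (h a b)) →
      Builds Pre Inv (λ P t → ∀ a b → Goal a b P (t a b)) (Q *ℕ (Q *ℕ c')) (buildTable h)
    buildTable-spec h Goal preSt goalSt c' step =
      buildAll-spec Q (λ a → buildAll Q (λ b → h a b)) (λ a P row → ∀ b → Goal a b P (row b)) preSt
        (λ a e g b → goalSt a b e (g b)) (Q *ℕ c')
        (λ a → buildAll-spec Q (λ b → h a b) (Goal a) preSt (goalSt a) c' (step a))

    translateGate : ∀ {k} → Vec Table k → Gate m k → Program N → Program N × Table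
    translateGate tab (inVar y) = buildTable (λ a b → push (entryGate (φ y a b)))
    translateGate tab (inConst a) = buildTable (λ a' b' → push (rConst (a * δ a' b')))
    translateGate tab (add i j) = buildTable (λ a b → push (rAdd (lookup tab i a b) (lookup tab j a b)))
    translateGate tab (mul i j) = buildTable (λ a b → dotProduct q (λ k' → lookup tab i a k') (λ k' → lookup tab j k' b))

    gateCost : ∀ {k} → Gate m k → ℕ
    gateCost (inVar _) = 1
    gateCost (inConst _) = 1
    gateCost (add _ _) = 1
    gateCost (mul _ _) = suc (q +ℕ q)

    module GateTranslation {k} (C : Circuit m k) (tab : Vec Table k) where
      vs : Vec (Series m) k
      vs = evalC C
      D D' : ℕ
      D = 2 ^ k
      D' = 2 ^ suc k

      Pre : Program N → Set ℓ
      Pre P = (∀ i a b → GateComputes P (lookup tab i a b) (substTrunc D (lookup vs i) a b)) ×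
              (Skew C → ∀ i → T (lookup (inputFlags C) i) → ∀ a b → InputGate P (lookup tab i a b))

      SkewWith : Gate m k → Set
      SkewWith g = Skew C × SkewGate (inputFlags C) g

      Goal : Gate m k → Fin Q → Fin Q → Program N → ℕ → Set ℓ
      Goal g a b P r = GateComputes P r (substTrunc D' (evalGate vs g) a b) × (SkewWith g → T (isInput g) → InputGate P r)

      pre-⊑ : ∀ {P P'} → P ⊑ P' → Pre P → Pre P'
      pre-⊑ e (computes , inputs) =
        (λ i a b → GateComputes-⊑ e (computes i a b)) , λ skC i ti a b → InputGate-⊑ e (inputs skC i ti a b)

      goal-⊑ : ∀ g a b {P P' x} → P ⊑ P' → Goal g a b P x → Goal g a b P' x
      goal-⊑ g a b e (computes , input) = GateComputes-⊑ e computes , λ sk t → InputGate-⊑ e (input sk t)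

      var-entries : ∀ y a b → Builds Pre (λ P → SkewWith (inVar y) → SkewProgram P) (Goal (inVar y) a b) 1
                                     (push (entryGate (φ y a b)))
      var-entries y a b =
        push-spec (entryGate (φ y a b))
          (λ P _ → (NP.≤-refl , λ w → begin
              valueAt (P ▸ entryGate (φ y a b)) (len P) w
                ≡⟨ P.cong (λ z → z w) (P.trans (valueAt-push P (entryGate (φ y a b))) (evalGate-entryGate P (φ y a b))) ⟩
              M y a b w
                ≈⟨ substTrunc-varₛ y a b w ⟨
              substTrunc 1 (varₛ y) a b w
                ≈⟨ substTrunc-stable 1 D' (varₛ y) (Deg≤-varₛ y) (NP.≤-trans (1≤2^k k) (2^k≤2^[1+k] k)) a b w ⟨
              substTrunc D' (varₛ y) a b w ∎) ,
            λ _ _ → NP.≤-refl , IsInputAt-entryGate P (φ y a b))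
          (λ P inv sk → Skew-entryGate P (φ y a b) (inv sk))

      const-entries : ∀ a₀ a b → Builds Pre (λ P → SkewWith (inConst a₀) → SkewProgram P) (Goal (inConst a₀) a b) 1
                                        (push (rConst (a₀ * δ a b)))
      const-entries a₀ a b =
        push-spec (rConst (a₀ * δ a b))
          (λ P _ → (NP.≤-refl , λ w → begin
              valueAt (P ▸ rConst (a₀ * δ a b)) (len P) w
                ≡⟨ P.cong (λ z → z w) (valueAt-push P (rConst (a₀ * δ a b))) ⟩
              constₛ (a₀ * δ a b) w
                ≈⟨ trans (constₛ≈*1ₛ _ w) (*-assoc _ _ _) ⟩
              a₀ * (δ a b * 1ₛ w)
                ≈⟨ *-congˡ (idM≈δ*1ₛ {N} {Q} a b w) ⟨
              a₀ * idM a b w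
                ≈⟨ substTrunc-stable 0 D' (constₛ a₀) (Deg≤-constₛ a₀) z≤n a b w ⟨
              substTrunc D' (constₛ a₀) a b w ∎) ,
            λ _ _ → NP.≤-refl , IsInputAt-rConst P (a₀ * δ a b))
          (λ P inv sk → Skew-rConst P (a₀ * δ a b) (inv sk))

      add-entries : (∀ i → Deg≤ D (lookup vs i)) → ∀ i j a b →
        Builds Pre (λ P → SkewWith (add i j) → SkewProgram P) (Goal (add i j) a b) 1
               (push (rAdd (lookup tab i a b) (lookup tab j a b)))
      add-entries deg i j a b =
        push-spec (rAdd (lookup tab i a b) (lookup tab j a b))
          (λ P (computes , _) → (NP.≤-refl , λ w → begin
              valueAt (P ▸ rAdd (lookup tab i a b) (lookup tab j a b)) (len P) w
                ≡⟨ P.cong (λ z → z w) (P.trans (valueAt-push P (rAdd (lookup tab i a b) (lookup tab j a b)))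
                                               (evalGate-rAdd P _ _ (proj₁ (computes i a b)) (proj₁ (computes j a b)))) ⟩
              valueAt P (lookup tab i a b) w + valueAt P (lookup tab j a b) w
                ≈⟨ +-cong (proj₂ (computes i a b) w) (proj₂ (computes j a b) w) ⟩
              substTrunc D (lookup vs i) a b w + substTrunc D (lookup vs j) a b w
                ≈⟨ substTrunc-+ₛ D (lookup vs i) (lookup vs j) a b w ⟨
              substTrunc D (lookup vs i +ₛ lookup vs j) a b w
                ≈⟨ substTrunc-stable D D' _ (Deg≤-+ₛ (deg i) (deg j)) (2^k≤2^[1+k] k) a b w ⟨
              substTrunc D' (lookup vs i +ₛ lookup vs j) a b w ∎) ,
            λ _ ())
          (λ P inv sk → Skew-rAdd P _ _ (inv sk))

      mul-entries : (∀ i → Deg≤ D (lookup vs i)) → ∀ i j a b →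
        Builds Pre (λ P → SkewWith (mul i j) → SkewProgram P) (Goal (mul i j) a b) (suc (q +ℕ q))
               (dotProduct q (λ k' → lookup tab i a k') (λ k' → lookup tab j k' b))
      mul-entries deg i j a b P (computes , inputs) =
        extension (extends r) (GateComputes-cong entry-of-product (achieves r) , λ _ ()) (len-≤ r) (preserves r)
        where
        sx sy : Fin Q → Series N
        sx k' = substTrunc D (lookup vs i) a k'
        sy k' = substTrunc D (lookup vs j) k' b
        side : SkewWith (mul i j) → (∀ k' → IsInputAt P (lookup tab i a k')) ⊎ (∀ k' → IsInputAt P (lookup tab j k' b))
        side (skC , inj₁ ti) = inj₁ (λ k' → proj₂ (inputs skC i ti a k'))
        side (skC , inj₂ tj) = inj₂ (λ k' → proj₂ (inputs skC j tj k' b))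
        r : Extension (λ P' → SkewWith (mul i j) → SkewProgram P') (λ P' r' → GateComputes P' r' (sumFinₛ Q (λ k' → sx k' *ₛ sy k')))
                      (suc (q +ℕ q)) P (dotProduct q (λ k' → lookup tab i a k') (λ k' → lookup tab j k' b) P)
        r = dotProduct-spec (SkewWith (mul i j)) q (λ k' → lookup tab i a k') (λ k' → lookup tab j k' b) sx sy P
              ((λ k' → computes i a k' , computes j k' b) , side)
        entry-of-product : sumFinₛ Q (λ k' → sx k' *ₛ sy k') ≈ₛ substTrunc D' (lookup vs i *ₛ lookup vs j) a b
        entry-of-product w =
          trans (sym (substTrunc-*ₛ D D (lookup vs i) (lookup vs j) (deg i) (deg j) a b w))
                (sym (substTrunc-stable (D +ℕ D) D' _ (Deg≤-*ₛ D D (deg i) (deg j)) (2^k+2^k≤2^[1+k] k) a b w))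

      translateGate-spec : (∀ i → Deg≤ D (lookup vs i)) → ∀ g →
        Builds Pre (λ P → SkewWith g → SkewProgram P) (λ P t → ∀ a b → Goal g a b P (t a b))
               (Q *ℕ (Q *ℕ gateCost g)) (translateGate tab g)
      translateGate-spec deg (inVar y)   = buildTable-spec _ _ pre-⊑ (goal-⊑ (inVar y))   1 (var-entries y)
      translateGate-spec deg (inConst a) = buildTable-spec _ _ pre-⊑ (goal-⊑ (inConst a)) 1 (const-entries a)
      translateGate-spec deg (add i j)   = buildTable-spec _ _ pre-⊑ (goal-⊑ (add i j))   1 (add-entries deg i j)
      translateGate-spec deg (mul i j)   = buildTable-spec _ _ pre-⊑ (goal-⊑ (mul i j)) (suc (q +ℕ q)) (mul-entries deg i j)

    translateCircuit : ∀ {k} → Circuit m k → Program N × Vec Table k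
    translateCircuit [] = ε , []
    translateCircuit (C ▷ g) =
      proj₁ (translateGate (proj₂ (translateCircuit C)) g (proj₁ (translateCircuit C))) ,
      (proj₂ (translateCircuit C) ∷ʳ proj₂ (translateGate (proj₂ (translateCircuit C)) g (proj₁ (translateCircuit C))))

    blockBound : ℕ
    blockBound = Q ^ 3 *ℕ 2

    gateCost≤blockBound : ∀ {k} (g : Gate m k) → Q *ℕ (Q *ℕ gateCost g) ≤ blockBound
    gateCost≤blockBound g = NP.≤-trans (NP.*-monoʳ-≤ Q (NP.*-monoʳ-≤ Q (gateCost≤ g))) (NP.≤-reflexive (regroup Q))
      where
      open import Data.Nat.Tactic.RingSolver
      regroup : ∀ X → X *ℕ (X *ℕ (X *ℕ 2)) P.≡ X *ℕ (X *ℕ (X *ℕ 1)) *ℕ 2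
      regroup = solve-∀
      double : ∀ y → suc (suc (y +ℕ y)) P.≡ suc y *ℕ 2
      double = solve-∀
      gateCost≤ : ∀ {k} (g : Gate m k) → gateCost g ≤ Q *ℕ 2
      gateCost≤ (inVar _)   = s≤s z≤n
      gateCost≤ (inConst _) = s≤s z≤n
      gateCost≤ (add _ _)   = s≤s z≤n
      gateCost≤ (mul _ _)   = NP.≤-trans (NP.n≤1+n _) (NP.≤-reflexive (double q))

    record TranslationInvariant {k} (C : Circuit m k) (P : Program N) (tab : Vec Table k) : Set ℓ where
      field
        size≤     : len P ≤ k *ℕ blockBound
        degrees   : ∀ i → Deg≤ (2 ^ k) (lookup (evalC C) i)
        entries   : ∀ i a b → GateComputes P (lookup tab i a b) (substTrunc (2 ^ k) (lookup (evalC C) i) a b)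
        skewness  : Skew C → SkewProgram P × (∀ i → T (lookup (inputFlags C) i) → ∀ a b → InputGate P (lookup tab i a b))
    open TranslationInvariant

    translateCircuit-spec : ∀ {k} (C : Circuit m k) → TranslationInvariant C (proj₁ (translateCircuit C)) (proj₂ (translateCircuit C))
    translateCircuit-spec [] = record { size≤ = z≤n ; degrees = λ () ; entries = λ () ; skewness = λ _ → tt , λ () }
    translateCircuit-spec {suc k} (C ▷ g) = record
      { size≤ = NP.≤-trans (len-≤ step) (NP.≤-trans (NP.+-mono-≤ (size≤ inv) (gateCost≤blockBound g))
                                                    (NP.≤-reflexive (NP.+-comm (k *ℕ blockBound) blockBound)))
      ; degrees = degrees′
      ; entries = entries′
      ; skewness = λ sk → preserves step (λ _ → proj₁ (skewness inv (proj₁ sk))) sk , inputs sk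
      }
      where
      inv : TranslationInvariant C (proj₁ (translateCircuit C)) (proj₂ (translateCircuit C))
      inv = translateCircuit-spec C
      P₀ P₁ : Program N
      P₀ = proj₁ (translateCircuit C)
      tab : Vec Table k
      tab = proj₂ (translateCircuit C)
      vs : Vec (Series m) k
      vs = evalC C
      v : Series m
      v = evalGate vs g
      step : Extension (λ P → GateTranslation.SkewWith C tab g → SkewProgram P)
                       (λ P t → ∀ a b → GateTranslation.Goal C tab g a b P (t a b)) (Q *ℕ (Q *ℕ gateCost g)) P₀ (translateGate tab g P₀)
      step = GateTranslation.translateGate-spec C tab (degrees inv) g P₀ (entries inv , λ skC → proj₂ (skewness inv skC))
      P₁ = proj₁ (translateGate tab g P₀)
      t : Table
      t = proj₂ (translateGate tab g P₀)
      degrees′ : ∀ i → Deg≤ (2 ^ suc k) (lookup (vs ∷ʳ v) i)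
      degrees′ i with inject₁-or-fromℕ i
      ... | inj₁ (j , P.refl) rewrite lookup-∷ʳ-inject₁ vs v j = Deg≤-mono (degrees inv j) (2^k≤2^[1+k] k)
      ... | inj₂ P.refl rewrite lookup-∷ʳ-fromℕ vs v = Deg≤-evalGate vs g (degrees inv)
      entries′ : ∀ i a b → GateComputes P₁ (lookup (tab ∷ʳ t) i a b) (substTrunc (2 ^ suc k) (lookup (vs ∷ʳ v) i) a b)
      entries′ i a b with inject₁-or-fromℕ i
      ... | inj₁ (j , P.refl) rewrite lookup-∷ʳ-inject₁ tab t j | lookup-∷ʳ-inject₁ vs v j =
            GateComputes-cong (λ w → sym (substTrunc-stable (2 ^ k) (2 ^ suc k) (lookup vs j) (degrees inv j) (2^k≤2^[1+k] k) a b w))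
                              (GateComputes-⊑ (extends step) (entries inv j a b))
      ... | inj₂ P.refl rewrite lookup-∷ʳ-fromℕ tab t | lookup-∷ʳ-fromℕ vs v = proj₁ (achieves step a b)
      inputs : Skew C × SkewGate (inputFlags C) g →
               ∀ i → T (lookup (inputFlags C ∷ʳ isInput g) i) → ∀ a b → InputGate P₁ (lookup (tab ∷ʳ t) i a b)
      inputs sk i ti a b with inject₁-or-fromℕ i
      ... | inj₁ (j , P.refl) rewrite lookup-∷ʳ-inject₁ tab t j | lookup-∷ʳ-inject₁ (inputFlags C) (isInput g) j =
            InputGate-⊑ (extends step) (proj₂ (skewness inv (proj₁ sk)) j ti a b)
      ... | inj₂ P.refl rewrite lookup-∷ʳ-fromℕ tab t | lookup-∷ʳ-fromℕ (inputFlags C) (isInput g) =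
            proj₂ (achieves step a b) sk ti

    -- The output has to be the last gate, so the entry (0, q) is copied there as a sum with 0.
    projectCircuit : ∀ {k} → Circuit m (suc k) → Program N
    projectCircuit {k} C =
      (proj₁ (translateCircuit C) ▸ rConst 0#) ▸
        rAdd (lookup (proj₂ (translateCircuit C)) (fromℕ k) zero (fromℕ q)) (len (proj₁ (translateCircuit C)))

    record ProjectionSpec {k} (C : Circuit m (suc k)) : Set ℓ where
      field
        size≤      : len (projectCircuit C) ≤ suc k *ℕ blockBound +ℕ 2
        output     : outC (toCircuit (projectCircuit C)) ≈ₛ substTrunc (2 ^ suc k) (outC C) zero (fromℕ q)
        outDegree  : Deg≤ (2 ^ suc k) (outC C)
        skew       : Skew C → Skew (toCircuit (projectCircuit C))

    projectCircuit-spec : ∀ {k} (C : Circuit m (suc k)) → ProjectionSpec C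
    projectCircuit-spec {k} C = record
      { size≤ = NP.≤-trans (NP.≤-reflexive (NP.+-comm 2 (len P₀))) (NP.+-monoˡ-≤ 2 (size≤ inv))
      ; output = output
      ; outDegree = P.subst (Deg≤ (2 ^ suc k)) (P.sym (outC≡lookup C)) (degrees inv (fromℕ k))
      ; skew = λ sk → Skew-rAdd P₁ r (len P₀) (Skew-rConst P₀ 0# (proj₁ (skewness inv sk)))
      }
      where
      inv : TranslationInvariant C (proj₁ (translateCircuit C)) (proj₂ (translateCircuit C))
      inv = translateCircuit-spec C
      P₀ P₁ : Program N
      P₀ = proj₁ (translateCircuit C)
      r : ℕ
      r = lookup (proj₂ (translateCircuit C)) (fromℕ k) zero (fromℕ q)
      P₁ = P₀ ▸ rConst 0#
      computes = entries inv (fromℕ k) zero (fromℕ q)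
      output : outC (toCircuit (projectCircuit C)) ≈ₛ substTrunc (2 ^ suc k) (outC C) zero (fromℕ q)
      output w = begin
        outC (toCircuit (projectCircuit C)) w
          ≡⟨ P.cong (λ z → z w) (VP.last-∷ʳ _ (values P₁)) ⟩
        evalGate (values P₁) (toGate (len P₁) (rAdd r (len P₀))) w
          ≡⟨ P.cong (λ z → z w) (evalGate-rAdd P₁ r (len P₀) (NP.m≤n⇒m≤1+n (proj₁ computes)) NP.≤-refl) ⟩
        valueAt P₁ r w + valueAt P₁ (len P₀) w
          ≡⟨ P.cong₂ (λ z₁ z₂ → z₁ w + z₂ w) (⊑-valueAt {P₀} {P₁} (⊑-step ⊑-refl) r (proj₁ computes)) (valueAt-push P₀ (rConst 0#)) ⟩
        valueAt P₀ r w + constₛ 0# w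
          ≈⟨ +-cong (proj₂ computes w) (trans (constₛ≈*1ₛ 0# w) (zeroˡ _)) ⟩
        substTrunc (2 ^ suc k) (lookup (evalC C) (fromℕ k)) zero (fromℕ q) w + 0#
          ≈⟨ +-identityʳ _ ⟩
        substTrunc (2 ^ suc k) (lookup (evalC C) (fromℕ k)) zero (fromℕ q) w
          ≡⟨ P.cong (λ z → substTrunc (2 ^ suc k) z zero (fromℕ q) w) (P.sym (outC≡lookup C)) ⟩
        substTrunc (2 ^ suc k) (outC C) zero (fromℕ q) w ∎

module Transfer {c ℓ} (F : Field c ℓ) where

  open import Level using (_⊔_)
  open import Data.Nat using (ℕ; suc; _≤_)
  import Data.Nat.Properties as NP
  open import Data.Fin using (zero; fromℕ)
  open import Data.Product using (Σ; _,_)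
  open Field F hiding (zero)
  open NC F
  open SeriesAlgebra F
  open Circuits F
  open Programs
  open PolyBounds

  ABPModel : PFamily → ℕ → ℕ → Set (c ⊔ ℓ)
  ABPModel h e n = Σ (ABP (nv h n) 1) λ A → sizeA A ≤ polyBound e n × Computes (evalA A zero) (poly h n)

  CircuitModel : PFamily → ℕ → ℕ → Set (c ⊔ ℓ)
  CircuitModel h e n = Σ ℕ λ k → Σ (Circuit (nv h n) (suc k)) λ C →
    suc k ≤ polyBound e n × Computes (outC C) (poly h n)

  SkewCircuitModel : PFamily → ℕ → ℕ → Set (c ⊔ ℓ)
  SkewCircuitModel h e n = Σ ℕ λ k → Σ (Circuit (nv h n) (suc k)) λ C →
    Skew C × suc k ≤ polyBound e n × Computes (outC C) (poly h n)

  module _ {f g : PFamily} (f≤g : f ≤abp g) where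
    open _≤abp_ f≤g

    substTrunc-computes-f : ∀ n D (s : Series (nv g (p n))) → Deg≤ D s → Computes s (poly g (p n)) →
      Computes (ABPTranslation.substTrunc (φ n) D s zero (fromℕ (q n))) (poly f n)
    substTrunc-computes-f n D s deg s≈g x =
      trans (ABPTranslation.substTrunc≈substM (φ n) D s (poly g (p n)) deg s≈g zero (fromℕ (q n)) x) (correct n x)

    projectCircuit-computes-f : ∀ n {k} (C : Circuit (nv g (p n)) (suc k)) → Computes (outC C) (poly g (p n)) →
      Computes (outC (toCircuit (CircuitTranslation.projectCircuit (φ n) C))) (poly f n)
    projectCircuit-computes-f n C C≈g x =
      trans (ProjectionSpec.output spec x) (substTrunc-computes-f n _ (outC C) (ProjectionSpec.outDegree spec) C≈g x)
      where
      open CircuitTranslation (φ n)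
      spec : ProjectionSpec C
      spec = projectCircuit-spec C

    ≤abp-HasPolyABP : HasPolyABP g → HasPolyABP f
    ≤abp-HasPolyABP (e , model) with translation-polyBounded pPoly qPoly e
    ... | e' , blowup = e' , λ n → translated n (model (p n))
      where
      translated : ∀ n → ABPModel g e (p n) → ABPModel f e' n
      translated n (A , A-size , A≈g) =
        projectABP A ,
        NP.≤-trans (sizeA-projectABP A) (blowup n (sizeA A) A-size) ,
        λ x → trans (evalA-projectABP A x) (substTrunc-computes-f n (depth A) (evalA A zero) (Deg≤-evalA A zero) A≈g x)
        where open ABPTranslation (φ n)

    ≤abp-HasPolyCircuit : HasPolyCircuit g → HasPolyCircuit f
    ≤abp-HasPolyCircuit (e , model) with translation-polyBounded pPoly qPoly e
    ... | e' , blowup = e' , λ n → translated n (model (p n))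
      where
      translated : ∀ n → CircuitModel g e (p n) → CircuitModel f e' n
      translated n (k , C , C-size , C≈g) =
        _ , toCircuit (projectCircuit C) ,
        NP.≤-trans (ProjectionSpec.size≤ (projectCircuit-spec C)) (blowup n (suc k) C-size) ,
        projectCircuit-computes-f n C C≈g
        where open CircuitTranslation (φ n)

    ≤abp-HasPolySkewCircuit : HasPolySkewCircuit g → HasPolySkewCircuit f
    ≤abp-HasPolySkewCircuit (e , model) with translation-polyBounded pPoly qPoly e
    ... | e' , blowup = e' , λ n → translated n (model (p n))
      where
      translated : ∀ n → SkewCircuitModel g e (p n) → SkewCircuitModel f e' n
      translated n (k , C , C-skew , C-size , C≈g) =
        _ , toCircuit (projectCircuit C) ,
        ProjectionSpec.skew (projectCircuit-spec C) C-skew ,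
        NP.≤-trans (ProjectionSpec.size≤ (projectCircuit-spec C)) (blowup n (suc k) C-size) ,
        projectCircuit-computes-f n C C≈g
        where open CircuitTranslation (φ n)

mainTheorem18 : ∀ {c ℓ : Level} (F : Field c ℓ) (f g : NC.PFamily F) →
    NC._≤abp_ F f g →
    (NC.HasPolyABP F g → NC.HasPolyABP F f) ×
    (NC.HasPolyCircuit F g → NC.HasPolyCircuit F f) ×
    (NC.HasPolySkewCircuit F g → NC.HasPolySkewCircuit F f)
mainTheorem18 F f g f≤g =
  Transfer.≤abp-HasPolyABP F f≤g , Transfer.≤abp-HasPolyCircuit F f≤g , Transfer.≤abp-HasPolySkewCircuit F f≤g
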